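{- The set $\mathcal L_6$ of real chords of $\mathcal C$ is a single $G$-orbit. For a real chord $\ell$: if $q\equiv5\pmod 6$ then $OD_2(\ell)=[0,2,q-1,0,0]$ and $OD_0(\ell)=[2,0,0,q-1,0]$; if $q\equiv 1\pmod 6$ then $OD_2(\ell)=[0,2,q-1,0,0]$ and $OD_0(\ell)=[2,0,\frac{q-1}{3},0,\frac{2(q-1)}{3}]$.
   Context: Let $q$ be a power of an odd prime with $3\nmid q$. In $\mathrm{PG}(3,q)$ with homogeneous coordinates $(Y_0,Y_1,Y_2,Y_3)$, let $\mathcal{C}=\{P(t)=(1,t,t^2,t^3): t\in\mathbb{F}_q\}\cup\{P(\infty)=(0,0,0,1)\}$ be the twisted cubic. A real chord is a line joining two distinct points of $\mathcal C$. Let $G\le \mathrm{PGL}(4,q)$ be the group of projectivities induced by the matrices $\begin{pmatrix} a^3&a^2b&ab^2&b^3\\ 3a^2c&a^2d+2abc&b^2c+2abd&3b^2d\\ 3ac^2&bc^2+2acd&ad^2+2bcd&3bd^2\\ c^3&c^2d&cd^2&d^3\end{pmatrix}$ with $a,b,c,d\in\mathbb{F}_q$, $ad-bc\neq0$. The osculating plane at $P(t)$ is $\Pi(t): -t^3Y_0+3t^2Y_1-3tY_2+Y_3=0$, and $\Pi(\infty): Y_0=0$. The tangent line at $P(t)$ is the line joining $P(t)$ and $(0,1,2t,3t^2)$; at $P(\infty)$ it is $Y_0=Y_1=0$. All points and planes are $\mathbb F_q$-rational. Point classes: $\mathcal P_1=\mathcal C$; $\mathcal P_2$ = points not on $\mathcal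 C$ on a tangent line; $\mathcal P_3$ = points on exactly three osculating planes; $\mathcal P_4$ = points not on $\mathcal C$ on exactly one osculating plane; $\mathcal P_5$ = points on no osculating plane. Plane classes: $\mathcal H_1$ = osculating planes; $\mathcal H_2$ = non-osculating planes meeting $\mathcal C$ in exactly two points; $\mathcal H_3$ = planes meeting $\mathcal C$ in exactly three points; $\mathcal H_4$ = non-osculating planes meeting $\mathcal C$ in exactly one point; $\mathcal H_5$ = planes disjoint from $\mathcal C$. $OD_0(\ell)$ lists the numbers of points of the line $\ell$ in $\mathcal P_1,\dots,\mathcal P_5$; $OD_2(\ell)$ lists the numbers of planes through $\ell$ in $\mathcal H_1,\dots,\mathcal H_5$. -}

module Defs where

open import Level using (0ℓ)
open import Data.Nat as ℕ using (ℕ)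
open import Data.Fin using (Fin; zero; suc)
open import Data.Maybe using (Maybe; just; nothing)
open import Data.List using (List; length)
open import Data.List.Relation.Unary.All using (All)
open import Data.List.Relation.Unary.Any using (Any)
open import Data.List.Relation.Unary.AllPairs using (AllPairs)
open import Data.List.Relation.Unary.Unique.Propositional using (Unique)
open import Data.List.Membership.Propositional using (_∈_)
open import Data.Vec using (Vec; []; _∷_; lookup)
open import Data.Product using (Σ; ∃; _×_; _,_)
open import Relation.Binary.PropositionalEquality using (_≡_)
open import Relation.Binary.Definitions using (DecidableEquality)
open import Relation.Nullary using (¬_)
open import Algebra.Core using (Op₁; Op₂)
open import Algebra.Structures using (IsCommutativeRing)

-- A finite field F_q (equality is propositional equality), with an
-- explicit duplicate-free enumeration of its elements; q = card.

record FiniteField : Set₁ where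
  infixl 6 _+_
  infixl 7 _*_
  field
    Carrier      : Set
    _+_ _*_      : Op₂ Carrier
    -_           : Op₁ Carrier
    0# 1#        : Carrier
    isCommutativeRing : IsCommutativeRing _≡_ _+_ _*_ -_ 0# 1#
    _⁻¹          : Op₁ Carrier
    ⁻¹-inverse   : ∀ x → ¬ x ≡ 0# → x * (x ⁻¹) ≡ 1#
    0≢1          : ¬ 0# ≡ 1#
    _≟_          : DecidableEquality Carrier
    elements     : List Carrier
    elements-complete : ∀ x → x ∈ elements
    elements-unique   : Unique elements

  card : ℕ
  card = length elements

-- Counting.  'CountMod _~_ P n' : the predicate P (assumed invariant
-- under the equivalence _~_) has exactly n ~-classes of solutions:
-- a list of n pairwise inequivalent solutions, such that every
-- solution is equivalent to one of them.

CountMod : {A : Set} → (A → A → Set) → (A → Set) → ℕ → Set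
CountMod {A} _~_ P n =
  Σ (List A) λ xs →
    length xs ≡ n × All P xs × AllPairs (λ a b → ¬ a ~ b) xs
    × (∀ a → P a → Any (a ~_) xs)

module Geometry (𝔽 : FiniteField) where
  open FiniteField 𝔽

  F = Carrier
  V = Vec F 4           -- homogeneous coordinates (Y0,Y1,Y2,Y3)

  2# 3# : F
  2# = 1# + 1#
  3# = 2# + 1#

  0v : V
  0v = 0# ∷ 0# ∷ 0# ∷ 0# ∷ []

  Nonzero : V → Set
  Nonzero x = ¬ x ≡ 0v

  _·_ : F → V → V
  k · (a ∷ b ∷ c ∷ d ∷ []) = k * a ∷ k * b ∷ k * c ∷ k * d ∷ []

  _⊕_ : V → V → V
  (a ∷ b ∷ c ∷ d ∷ []) ⊕ (a' ∷ b' ∷ c' ∷ d' ∷ []) =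
    a + a' ∷ b + b' ∷ c + c' ∷ d + d' ∷ []

  dot : V → V → F
  dot (a ∷ b ∷ c ∷ d ∷ []) (a' ∷ b' ∷ c' ∷ d' ∷ []) =
    a * a' + b * b' + c * c' + d * d'

  _~_ : V → V → Set
  x ~ y = Σ F λ k → ¬ k ≡ 0# × x ≡ k · y

  OnPlane : V → V → Set
  OnPlane π x = dot π x ≡ 0#

  OnLine : V → V → V → Set
  OnLine u w x = Σ F λ α → Σ F λ β → x ≡ (α · u) ⊕ (β · w)

  PlaneThroughLine : V → V → V → Set
  PlaneThroughLine u w π = OnPlane π u × OnPlane π w

  -- parameters F ∪ {∞}; nothing = ∞
  Param = Maybe F

  cube : F → F
  cube t = t * t * t

  P : Param → V
  P (just t) = 1# ∷ t ∷ t * t ∷ cube t ∷ []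
  P nothing  = 0# ∷ 0# ∷ 0# ∷ 1# ∷ []

  -- second point spanning the tangent line at P(t)
  T : Param → V
  T (just t) = 0# ∷ 1# ∷ 2# * t ∷ 3# * (t * t) ∷ []
  T nothing  = 0# ∷ 0# ∷ 1# ∷ 0# ∷ []

  Π : Param → V
  Π (just t) = - cube t ∷ 3# * (t * t) ∷ - (3# * t) ∷ 1# ∷ []
  Π nothing  = 1# ∷ 0# ∷ 0# ∷ 0# ∷ []

  -- point classes (for nonzero x)

  OnC : V → Set
  OnC x = Σ Param λ t → x ~ P t

  OnTangent : V → Set
  OnTangent x = Σ Param λ t → OnLine (P t) (T t) x

  OscCount : V → ℕ → Set
  OscCount x n = CountMod _≡_ (λ t → OnPlane (Π t) x) n

  𝒫 : Fin 5 → V → Set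
  𝒫 zero x                      = OnC x
  𝒫 (suc zero) x                = ¬ OnC x × OnTangent x
  𝒫 (suc (suc zero)) x          = OscCount x 3
  𝒫 (suc (suc (suc zero))) x    = ¬ OnC x × OscCount x 1
  𝒫 (suc (suc (suc (suc zero)))) x = OscCount x 0

  -- plane classes (for nonzero π)

  Osculating : V → Set
  Osculating π = Σ Param λ t → π ~ Π t

  MeetCount : V → ℕ → Set
  MeetCount π n = CountMod _≡_ (λ t → OnPlane π (P t)) n

  ℋ : Fin 5 → V → Set
  ℋ zero π                      = Osculating π
  ℋ (suc zero) π                = ¬ Osculating π × MeetCount π 2
  ℋ (suc (suc zero)) π          = MeetCount π 3
  ℋ (suc (suc (suc zero))) π    = ¬ Osculating π × MeetCount π 1
  ℋ (suc (suc (suc (suc zero)))) π = MeetCount π 0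

  OD₀ : V → V → Vec ℕ 5 → Set
  OD₀ u w ns = ∀ i →
    CountMod _~_ (λ x → Nonzero x × OnLine u w x × 𝒫 i x) (lookup ns i)

  OD₂ : V → V → Vec ℕ 5 → Set
  OD₂ u w ns = ∀ i →
    CountMod _~_ (λ π → Nonzero π × PlaneThroughLine u w π × ℋ i π) (lookup ns i)

  -- the group G: the projectivity with parameters a b c d acts on
  -- row vectors, x ↦ x M (this is the action that maps 𝒞 to 𝒞)

  det : F → F → F → F → F
  det a b c d = a * d + - (b * c)

  g : F → F → F → F → V → V
  g a b c d (y0 ∷ y1 ∷ y2 ∷ y3 ∷ []) =
      (y0 * cube a + y1 * (3# * (a * a * c)) + y2 * (3# * (a * c * c)) + y3 * cube c)
    ∷ (y0 * (a * a * b) + y1 * (a * a * d + 2# * (a * b * c))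
         + y2 * (b * c * c + 2# * (a * c * d)) + y3 * (c * c * d))
    ∷ (y0 * (a * b * b) + y1 * (b * b * c + 2# * (a * b * d))
         + y2 * (a * d * d + 2# * (b * c * d)) + y3 * (c * d * d))
    ∷ (y0 * cube b + y1 * (3# * (b * b * d)) + y2 * (3# * (b * d * d)) + y3 * cube d)
    ∷ []

  -- a line, given as the set of vectors of its underlying 2-space
  Line = V → Set

  Span : V → V → Line
  Span u w = OnLine u w

  Image : F → F → F → F → Line → Line
  Image a b c d ℓ x = Σ V λ y → ℓ y × x ≡ g a b c d y

  SameLine : Line → Line → Set
  SameLine ℓ m = ∀ x → (ℓ x → m x) × (m x → ℓ x)

  Chord : Param → Param → Line
  Chord s t = Span (P s) (P t)

{-# OPTIONS --safe #-}
-- Write points of PG(1,q) as pairs v and the twisted cubic as ν v = (v₀³, v₀²v₁, v₀v₁², v₁³). A plane π then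
-- becomes the binary cubic form v ↦ π · ν v, whose roots are the points where π meets 𝒞, and G acts on 𝒞
-- through PGL(2,q), which is transitive on pairs of points; so G is transitive on real chords.
-- For the chord P(s)P(t), a plane through it has a form with roots s, t and a third root w, and is determined
-- by w: the two choices w ∈ {s, t} give planes meeting 𝒞 twice, the other q - 1 give planes meeting it three
-- times. A point P(s) - l·P(t), l ≠ 0, lies on the osculating plane Π(u) exactly when (det(u,s)/det(u,t))³ = l,
-- so its osculating planes correspond to the cube roots of l: one for every l when q ≡ 5 (mod 6), where
-- cubing is a bijection, and three or none according as l is a cube when q ≡ 1 (mod 6), where the cubes are
-- a third of F*.
module Submission where

open import Defs
open import Level using (0ℓ)
open import Data.Nat as ℕ using (ℕ; zero; suc; _≤_; z≤n; s≤s)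
import Data.Nat.Properties as ℕₚ
open import Data.Integer as ℤ using (ℤ; -[1+_]; _⊖_)
import Data.Integer.Properties as ℤₚ
open import Data.Sign as Sign using (Sign)
open import Data.Maybe using (Maybe; just; nothing)
open import Data.Product using (Σ; _×_; _,_; proj₁; proj₂)
open import Data.Sum using (_⊎_; inj₁; inj₂)
open import Data.Empty using (⊥; ⊥-elim)
open import Data.Unit using (⊤)
open import Data.Vec using ([]; _∷_; head; last)
open import Data.Fin using (Fin; zero; suc)
open import Data.List using (List; []; _∷_; length; map; filter)
open import Data.List.Properties using (length-map; filter-notAll)
open import Data.List.Relation.Unary.All as All using (All; []; _∷_)
import Data.List.Relation.Unary.All.Properties as Allₚ
open import Data.List.Relation.Unary.Any as Any using (Any; here; there)
import Data.List.Relation.Unary.Any.Properties as Anyₚ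
open import Data.List.Relation.Unary.AllPairs as AllPairs using (AllPairs; []; _∷_)
import Data.List.Relation.Unary.AllPairs.Properties as AllPairsₚ
open import Data.List.Relation.Unary.Unique.Propositional using (Unique)
import Data.List.Relation.Unary.Unique.Propositional.Properties as Uniqueₚ
open import Data.List.Membership.Propositional using (_∈_; lose; find)
open import Data.List.Membership.Propositional.Properties using (∈-filter⁺; ∈-filter⁻; ∈-map⁻; ∈-map⁺)
import Data.Maybe.Properties as Maybeₚ
open import Relation.Nullary using (¬_; Dec; yes; no; ¬?)
open import Relation.Unary using (Decidable)
open import Relation.Unary.Properties using (∁?)
open import Relation.Binary.Definitions using (DecidableEquality)
open import Relation.Binary.PropositionalEquality
open import Algebra.Core using (Op₂)
open import Algebra.Bundles using (CommutativeRing)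
open import Algebra.Structures using (IsCommutativeRing)
import Algebra.Solver.Ring.AlmostCommutativeRing as ACR

module _ {A : Set} {P : A → Set} (P? : Decidable P) where

  length-filter+length-filter-∁ : ∀ xs → length (filter P? xs) ℕ.+ length (filter (∁? P?) xs) ≡ length xs
  length-filter+length-filter-∁ [] = refl
  length-filter+length-filter-∁ (x ∷ xs) with P? x
  ... | yes _ = cong suc (length-filter+length-filter-∁ xs)
  ... | no _ = trans (ℕₚ.+-suc _ _) (cong suc (length-filter+length-filter-∁ xs))

  filter-countMod : ∀ {Q : A → Set} xs → Unique xs → (∀ {x} → x ∈ xs → Q x) → (∀ {x} → Q x → x ∈ xs) →
                    CountMod _≡_ (λ x → Q x × P x) (length (filter P? xs))
  filter-countMod {Q} xs xs! xs⊆Q Q⊆xs =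
      filter P? xs , refl , All.tabulate Q×P , Uniqueₚ.filter⁺ P? xs! , λ x (Qx , Px) → ∈-filter⁺ P? (Q⊆xs Qx) Px
    where
      Q×P : ∀ {x} → x ∈ filter P? xs → Q x × P x
      Q×P x∈ = let (x∈xs , Px) = ∈-filter⁻ P? {xs = xs} x∈ in xs⊆Q x∈xs , Px

module _ {A B : Set} {_~_ : B → B → Set} {P : A → Set} {Q : B → Set} (f : A → B) where

  countMod-image : ∀ {n} → CountMod _≡_ P n → (∀ {a} → P a → Q (f a)) →
                   (∀ {a a'} → P a → P a' → f a ~ f a' → a ≡ a') →
                   (∀ b → Q b → Σ A λ a → P a × b ~ f a) → CountMod _~_ Q n
  countMod-image (xs , |xs|≡n , P-xs , xs! , cover) P⇒Q f-injective Q⇒image =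
      map f xs , trans (length-map f xs) |xs|≡n , Allₚ.map⁺ (All.map P⇒Q P-xs) , AllPairsₚ.map⁺ (apart P-xs xs!) , image-cover
    where
      apart : ∀ {ys} → All P ys → Unique ys → AllPairs (λ a a' → ¬ f a ~ f a') ys
      apart [] [] = []
      apart (Py ∷ P-ys) (y∉ys ∷ ys!) = All.zipWith (λ (Py' , y≢y') fy~fy' → y≢y' (f-injective Py Py' fy~fy')) (P-ys , y∉ys) ∷ apart P-ys ys!
      image-cover : ∀ b → Q b → Any (b ~_) (map f xs)
      image-cover b Qb with Q⇒image b Qb
      ... | a , Pa , b~fa = Anyₚ.map⁺ (Any.map (λ a≡x → subst (λ z → b ~ f z) a≡x b~fa) (cover a Pa))

countMod-none : {B : Set} {_~_ : B → B → Set} {Q : B → Set} → (∀ b → ¬ Q b) → CountMod _~_ Q 0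
countMod-none ¬Q = [] , refl , [] , [] , λ b Qb → ⊥-elim (¬Q b Qb)

countMod-⇔ : {B : Set} {_~_ : B → B → Set} {P Q : B → Set} {n : ℕ} →
             (∀ {b} → P b → Q b) → (∀ {b} → Q b → P b) → CountMod _~_ P n → CountMod _~_ Q n
countMod-⇔ P⇒Q Q⇒P (xs , |xs|≡n , P-xs , apart , cover) = xs , |xs|≡n , All.map P⇒Q P-xs , apart , λ b Qb → cover b (Q⇒P Qb)

module DecidableLists {A : Set} (_≟_ : DecidableEquality A) where

  infixl 6 _without_
  _without_ : List A → A → List A
  xs without x = filter (λ y → ¬? (y ≟ x)) xs

  ∈-without⁺ : ∀ {x y xs} → y ∈ xs → ¬ y ≡ x → y ∈ xs without x
  ∈-without⁺ {x} = ∈-filter⁺ (λ y → ¬? (y ≟ x))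

  ∈-without⁻ : ∀ {x y} xs → y ∈ xs without x → y ∈ xs × ¬ y ≡ x
  ∈-without⁻ {x} xs = ∈-filter⁻ (λ y → ¬? (y ≟ x)) {xs = xs}

  without-unique : ∀ {x xs} → Unique xs → Unique (xs without x)
  without-unique {x} = Uniqueₚ.filter⁺ (λ y → ¬? (y ≟ x))

  length-without< : ∀ {x xs} → x ∈ xs → suc (length (xs without x)) ≤ length xs
  length-without< {x} x∈xs = filter-notAll (λ y → ¬? (y ≟ x)) _ (Any.map (λ x≡y y≢x → y≢x (sym x≡y)) x∈xs)

  unique-⊆⇒length≤ : ∀ xs ys → Unique xs → (∀ {z} → z ∈ xs → z ∈ ys) → length xs ≤ length ys
  unique-⊆⇒length≤ [] ys _ _ = z≤n
  unique-⊆⇒length≤ (x ∷ xs) ys (x∉xs ∷ xs!) xs⊆ys =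
    ℕₚ.≤-trans (s≤s (unique-⊆⇒length≤ xs (ys without x) xs! xs⊆ys-x)) (length-without< (xs⊆ys (here refl)))
    where
      xs⊆ys-x : ∀ {z} → z ∈ xs → z ∈ ys without x
      xs⊆ys-x z∈xs = ∈-without⁺ (xs⊆ys (there z∈xs)) (λ z≡x → All.lookup x∉xs z∈xs (sym z≡x))

  length-without : ∀ {x xs} → Unique xs → x ∈ xs → suc (length (xs without x)) ≡ length xs
  length-without {x} {xs} xs! x∈xs = ℕₚ.≤-antisym (length-without< x∈xs)
    (unique-⊆⇒length≤ xs (x ∷ xs without x) xs! xs⊆x∷xs-x)
    where
      xs⊆x∷xs-x : ∀ {z} → z ∈ xs → z ∈ x ∷ xs without x
      xs⊆x∷xs-x {z} z∈xs with z ≟ x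
      ... | yes z≡x = here z≡x
      ... | no z≢x = there (∈-without⁺ z∈xs z≢x)

  countMod≡-bound : ∀ {P : A → Set} {n ys} → CountMod _≡_ P n → Unique ys → All P ys → length ys ≤ n
  countMod≡-bound {ys = ys} (xs , refl , _ , _ , cover) ys! P-ys =
    unique-⊆⇒length≤ ys xs ys! (λ z∈ys → cover _ (All.lookup P-ys z∈ys))

  countMod≡-unique : ∀ {P Q : A → Set} {m n} → CountMod _≡_ P m → CountMod _≡_ Q n →
                     (∀ {x} → P x → Q x) → (∀ {x} → Q x → P x) → m ≡ n
  countMod≡-unique count-P@(xs , refl , P-xs , xs! , _) count-Q@(ys , refl , Q-ys , ys! , _) P⇒Q Q⇒P =
    ℕₚ.≤-antisym (countMod≡-bound count-Q xs! (All.map P⇒Q P-xs)) (countMod≡-bound count-P ys! (All.map Q⇒P Q-ys))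

  two-excluded-count : ∀ xs → Unique xs → (∀ x → x ∈ xs) → ∀ {s t} → ¬ s ≡ t →
                       CountMod _≡_ (λ w → ¬ w ≡ s × ¬ w ≡ t) (length xs ℕ.∸ 2)
  two-excluded-count xs xs! complete {s} {t} s≢t =
      xs without s without t , cong (ℕ._∸ 2) 2+length , All.tabulate excluded , without-unique (without-unique xs!) ,
      λ w (w≢s , w≢t) → ∈-without⁺ (∈-without⁺ (complete w) w≢s) w≢t
    where
      2+length : suc (suc (length (xs without s without t))) ≡ length xs
      2+length = trans (cong suc (length-without (without-unique xs!) (∈-without⁺ (complete t) (≢-sym s≢t))))
                       (length-without xs! (complete s))
      excluded : ∀ {w} → w ∈ xs without s without t → ¬ w ≡ s × ¬ w ≡ t
      excluded w∈ = proj₂ (∈-without⁻ xs (proj₁ (∈-without⁻ (xs without s) w∈))) , proj₂ (∈-without⁻ (xs without s) w∈)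

  module TripleOrbits (Good : A → Set) (σ : A → A)
      (σ-good : ∀ {x} → Good x → Good (σ x))
      (σ³≡id : ∀ {x} → Good x → σ (σ (σ x)) ≡ x)
      (σ-fixpoint-free : ∀ {x} → Good x → ¬ σ x ≡ x) where

    InOrbitOf : A → A → Set
    InOrbitOf r x = x ≡ r ⊎ x ≡ σ r ⊎ x ≡ σ (σ r)

    σ-injective : ∀ {x y} → Good x → Good y → σ x ≡ σ y → x ≡ y
    σ-injective gx gy σx≡σy = trans (sym (σ³≡id gx)) (trans (cong (λ z → σ (σ z)) σx≡σy) (σ³≡id gy))

    record Transversal (L : List A) : Set where
      field
        reps : List A
        3*length-reps : 3 ℕ.* length reps ≡ length L
        reps⊆L : All (_∈ L) reps
        covers : ∀ {x} → x ∈ L → Any (λ r → InOrbitOf r x) reps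
        disjoint : AllPairs (λ r r' → ¬ InOrbitOf r r') reps

    module WithoutOrbit (x : A) (rest : List A) (gx : Good x) (x∉rest : All (λ y → ¬ x ≡ y) rest)
        (rest! : Unique rest) (closed : ∀ {y} → y ∈ x ∷ rest → σ y ∈ x ∷ rest) where

      rest₁ = rest without σ x
      rest₂ = rest₁ without σ (σ x)

      y∈rest⇒y≢x : ∀ {y} → y ∈ rest → ¬ y ≡ x
      y∈rest⇒y≢x y∈rest y≡x = All.lookup x∉rest y∈rest (sym y≡x)

      σ²x≢x : ¬ σ (σ x) ≡ x
      σ²x≢x σ²x≡x = σ-fixpoint-free gx (trans (cong σ (sym σ²x≡x)) (σ³≡id gx))

      ∈rest : ∀ {y} → y ∈ x ∷ rest → ¬ y ≡ x → y ∈ rest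
      ∈rest (here y≡x) y≢x = ⊥-elim (y≢x y≡x)
      ∈rest (there y∈rest) _ = y∈rest

      σx∈rest₁ : σ (σ x) ∈ rest₁
      σx∈rest₁ = ∈-without⁺ (∈rest (closed (closed (here refl))) σ²x≢x) (σ-fixpoint-free (σ-good gx))

      rest₂⊆rest : ∀ {y} → y ∈ rest₂ → y ∈ rest
      rest₂⊆rest y∈ = proj₁ (∈-without⁻ rest (proj₁ (∈-without⁻ rest₁ y∈)))

      rest₂-unique : Unique rest₂
      rest₂-unique = without-unique (without-unique rest!)

      length-rest₂ : suc (suc (length rest₂)) ≡ length rest
      length-rest₂ = trans (cong suc (length-without (without-unique rest!) σx∈rest₁))
        (length-without rest! (∈rest (closed (here refl)) (σ-fixpoint-free gx)))

      rest₂-closed : (∀ {y} → y ∈ rest → Good y) → ∀ {y} → y ∈ rest₂ → σ y ∈ rest₂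
      rest₂-closed good {y} y∈ = ∈-without⁺ (∈-without⁺ σy∈rest σy≢σx) σy≢σ²x
        where
          y∈rest₁ = ∈-without⁻ rest₁ y∈
          y∈rest = ∈-without⁻ rest (proj₁ y∈rest₁)
          gy = good (proj₁ y∈rest)
          σy∈rest : σ y ∈ rest
          σy∈rest = ∈rest (closed (there (proj₁ y∈rest)))
            (λ σy≡x → proj₂ y∈rest₁ (trans (sym (σ³≡id gy)) (cong (λ z → σ (σ z)) σy≡x)))
          σy≢σx : ¬ σ y ≡ σ x
          σy≢σx e = y∈rest⇒y≢x (proj₁ y∈rest) (σ-injective gy gx e)
          σy≢σ²x : ¬ σ y ≡ σ (σ x)
          σy≢σ²x e = proj₂ y∈rest (σ-injective gy (σ-good gx) e)

      rest₁-not-in-orbit : ∀ {y} → y ∈ rest₁ → ¬ y ≡ σ (σ x) → ¬ InOrbitOf x y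
      rest₁-not-in-orbit y∈ _ (inj₁ y≡x) = y∈rest⇒y≢x (proj₁ (∈-without⁻ rest y∈)) y≡x
      rest₁-not-in-orbit y∈ _ (inj₂ (inj₁ y≡σx)) = proj₂ (∈-without⁻ rest y∈) y≡σx
      rest₁-not-in-orbit _ y≢σ²x (inj₂ (inj₂ y≡σ²x)) = y≢σ²x y≡σ²x

    transversal-fuel : ∀ fuel L → length L ≤ fuel → Unique L → (∀ {x} → x ∈ L → Good x) →
                       (∀ {x} → x ∈ L → σ x ∈ L) → Transversal L
    transversal-fuel _ [] _ _ _ _ = record { reps = [] ; 3*length-reps = refl ; reps⊆L = [] ; covers = λ () ; disjoint = [] }
    transversal-fuel (suc fuel) (x ∷ rest) (s≤s |L|≤fuel) (x∉rest ∷ rest!) good closed = record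
        { reps = x ∷ T.reps
        ; 3*length-reps = trans (ℕₚ.*-suc 3 (length T.reps)) (trans (cong (3 ℕ.+_) T.3*length-reps) (cong suc length-rest₂))
        ; reps⊆L = here refl ∷ All.map (λ r∈ → there (rest₂⊆rest r∈)) T.reps⊆L
        ; covers = cover
        ; disjoint = All.map (λ {r} r∈ → rest₁-not-in-orbit (proj₁ (∈-without⁻ rest₁ r∈)) (proj₂ (∈-without⁻ rest₁ r∈))) T.reps⊆L
                     ∷ T.disjoint
        }
      where
        open WithoutOrbit x rest (good (here refl)) x∉rest rest! closed
        T : Transversal rest₂
        T = transversal-fuel fuel rest₂
              (ℕₚ.≤-trans (ℕₚ.n≤1+n _) (ℕₚ.≤-trans (ℕₚ.n≤1+n _) (ℕₚ.≤-trans (ℕₚ.≤-reflexive length-rest₂) |L|≤fuel)))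
              rest₂-unique (λ y∈ → good (there (rest₂⊆rest y∈))) (rest₂-closed (λ y∈ → good (there y∈)))
        module T = Transversal T
        cover : ∀ {y} → y ∈ x ∷ rest → Any (λ r → InOrbitOf r y) (x ∷ T.reps)
        cover (here y≡x) = here (inj₁ y≡x)
        cover {y} (there y∈rest) with y ≟ σ x | y ≟ σ (σ x)
        ... | yes y≡σx | _ = here (inj₂ (inj₁ y≡σx))
        ... | no _ | yes y≡σ²x = here (inj₂ (inj₂ y≡σ²x))
        ... | no y≢σx | no y≢σ²x = there (T.covers (∈-without⁺ (∈-without⁺ y∈rest y≢σx) y≢σ²x))

    transversal : ∀ L → Unique L → (∀ {x} → x ∈ L → Good x) → (∀ {x} → x ∈ L → σ x ∈ L) → Transversal L
    transversal L = transversal-fuel (length L) L ℕₚ.≤-refl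

module Residues where

  open import Data.Nat using (_+_; _*_; _%_; _/_; _∸_)
  open import Data.Nat.DivMod using ([m+kn]%n≡m%n; m≡m%n+[m/n]*n; m*n/n≡m)
  open import Data.Nat.Solver using (module +-*-Solver)
  open +-*-Solver using (solve; _:=_; _:+_; _:*_; con)

  [a+3k]%3≡a%3 : ∀ a k → (a + 3 * k) % 3 ≡ a % 3
  [a+3k]%3≡a%3 a k = trans (cong (λ z → (a + z) % 3) (ℕₚ.*-comm 3 k)) ([m+kn]%n≡m%n a k 3)

  q%3-from-q%6 : ∀ q {r} → q % 6 ≡ r → q % 3 ≡ (r + 3 * (2 * (q / 6))) % 3
  q%3-from-q%6 q {r} q%6≡r = cong (_% 3) (begin
      q                          ≡⟨ m≡m%n+[m/n]*n q 6 ⟩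
      q % 6 + q / 6 * 6          ≡⟨ cong₂ _+_ q%6≡r (solve 1 (λ t → t :* con 6 := con 3 :* (con 2 :* t)) refl (q / 6)) ⟩
      r + 3 * (2 * (q / 6))      ∎)
    where open ≡-Reasoning

  q%6≡5⇒1+3k≢q : ∀ q k → q % 6 ≡ 5 → ¬ suc (3 * k) ≡ q
  q%6≡5⇒1+3k≢q q k q%6≡5 1+3k≡q with
    trans (sym ([a+3k]%3≡a%3 1 k)) (trans (cong (_% 3) 1+3k≡q)
      (trans (q%3-from-q%6 q q%6≡5)
      (trans (cong (_% 3) (solve 1 (λ t → con 5 :+ con 3 :* (con 2 :* t) := con 2 :+ con 3 :* (con 1 :+ con 2 :* t)) refl (q / 6)))
        ([a+3k]%3≡a%3 2 (1 + 2 * (q / 6))))))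
  ... | ()

  q%6≡1⇒2+3k≢q : ∀ q k → q % 6 ≡ 1 → ¬ suc (suc (3 * k)) ≡ q
  q%6≡1⇒2+3k≢q q k q%6≡1 2+3k≡q with
    trans (sym ([a+3k]%3≡a%3 2 k)) (trans (cong (_% 3) 2+3k≡q) (trans (q%3-from-q%6 q q%6≡1) ([a+3k]%3≡a%3 1 (2 * (q / 6)))))
  ... | ()

  q%3≢0⇒3k≢q : ∀ q k → ¬ q % 3 ≡ 0 → ¬ 3 * k ≡ q
  q%3≢0⇒3k≢q q k q%3≢0 3k≡q = q%3≢0 (trans (cong (_% 3) (sym 3k≡q)) ([a+3k]%3≡a%3 0 k))

  1+3r≡q⇒[q∸1]/3≡r : ∀ q r → suc (3 * r) ≡ q → (q ∸ 1) / 3 ≡ r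
  1+3r≡q⇒[q∸1]/3≡r q r refl = trans (cong (_/ 3) (ℕₚ.*-comm 3 r)) (m*n/n≡m r 3)

  1+3r≡q∧r+n≡q∸1⇒n≡2[q∸1]/3 : ∀ q r n → suc (3 * r) ≡ q → r + n ≡ q ∸ 1 → n ≡ 2 * ((q ∸ 1) / 3)
  1+3r≡q∧r+n≡q∸1⇒n≡2[q∸1]/3 q r n 1+3r≡q r+n≡q∸1 = begin
      n                     ≡⟨ ℕₚ.+-cancelˡ-≡ r n (2 * r) (trans r+n≡q∸1 (trans (cong (_∸ 1) (sym 1+3r≡q)) 3r≡r+2r)) ⟩
      2 * r                 ≡⟨ cong (2 *_) (sym (1+3r≡q⇒[q∸1]/3≡r q r 1+3r≡q)) ⟩
      2 * ((q ∸ 1) / 3)     ∎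
    where
      open ≡-Reasoning
      3r≡r+2r : 3 * r ≡ r + 2 * r
      3r≡r+2r = solve 1 (λ r → con 3 :* r := r :+ con 2 :* r) refl r

-- Ring equations in 𝔽 are solved with integer coefficients, since Algebra.Solver.Ring decides equality of
-- coefficients by computation.
module FieldArithmetic (𝔽 : FiniteField) where

  open FiniteField 𝔽 public
  open Geometry 𝔽 public using (2#; 3#; cube)
  open IsCommutativeRing isCommutativeRing public
    using (+-assoc; +-comm; *-assoc; *-comm; +-identityˡ; +-identityʳ; *-identityˡ; *-identityʳ;
           distribˡ; distribʳ; zeroˡ; zeroʳ; -‿inverseˡ; -‿inverseʳ)

  commutativeRing : CommutativeRing 0ℓ 0ℓ
  commutativeRing = record { isCommutativeRing = isCommutativeRing }

  open import Algebra.Properties.Ring (CommutativeRing.ring commutativeRing) public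
    using (-‿involutive; -‿injective; -0#≈0#; -‿distribˡ-*; -‿distribʳ-*; -‿anti-homo-+)
    renaming (x∙y⁻¹≈ε⇒x≈y to x-y≡0⇒x≡y; x≈y⇒x∙y⁻¹≈ε to x≡y⇒x-y≡0)

  infixl 6 _-_
  _-_ : Op₂ Carrier
  x - y = x + - y

  -- Peeled so that ⟦ 2 ⟧ℕ and ⟦ 3 ⟧ℕ are definitionally the 2# and 3# of Geometry.
  ⟦_⟧ℕ : ℕ → Carrier
  ⟦ zero ⟧ℕ = 0#
  ⟦ suc zero ⟧ℕ = 1#
  ⟦ suc (suc n) ⟧ℕ = ⟦ suc n ⟧ℕ + 1#

  ⟦suc⟧ℕ : ∀ n → ⟦ suc n ⟧ℕ ≡ ⟦ n ⟧ℕ + 1#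
  ⟦suc⟧ℕ zero = sym (+-identityˡ 1#)
  ⟦suc⟧ℕ (suc n) = refl

  ⟦+⟧ℕ : ∀ m n → ⟦ m ℕ.+ n ⟧ℕ ≡ ⟦ m ⟧ℕ + ⟦ n ⟧ℕ
  ⟦+⟧ℕ zero n = sym (+-identityˡ _)
  ⟦+⟧ℕ (suc m) n = begin
      ⟦ suc (m ℕ.+ n) ⟧ℕ        ≡⟨ ⟦suc⟧ℕ (m ℕ.+ n) ⟩
      ⟦ m ℕ.+ n ⟧ℕ + 1#         ≡⟨ cong (_+ 1#) (⟦+⟧ℕ m n) ⟩
      ⟦ m ⟧ℕ + ⟦ n ⟧ℕ + 1#      ≡⟨ +-assoc _ _ _ ⟩
      ⟦ m ⟧ℕ + (⟦ n ⟧ℕ + 1#)    ≡⟨ cong (⟦ m ⟧ℕ +_) (+-comm _ _) ⟩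
      ⟦ m ⟧ℕ + (1# + ⟦ n ⟧ℕ)    ≡⟨ sym (+-assoc _ _ _) ⟩
      ⟦ m ⟧ℕ + 1# + ⟦ n ⟧ℕ      ≡⟨ cong (_+ ⟦ n ⟧ℕ) (sym (⟦suc⟧ℕ m)) ⟩
      ⟦ suc m ⟧ℕ + ⟦ n ⟧ℕ       ∎
    where open ≡-Reasoning

  ⟦*⟧ℕ : ∀ m n → ⟦ m ℕ.* n ⟧ℕ ≡ ⟦ m ⟧ℕ * ⟦ n ⟧ℕ
  ⟦*⟧ℕ zero n = sym (zeroˡ _)
  ⟦*⟧ℕ (suc m) n = begin
      ⟦ n ℕ.+ m ℕ.* n ⟧ℕ               ≡⟨ ⟦+⟧ℕ n (m ℕ.* n) ⟩
      ⟦ n ⟧ℕ + ⟦ m ℕ.* n ⟧ℕ            ≡⟨ cong₂ _+_ (sym (*-identityˡ _)) (⟦*⟧ℕ m n) ⟩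
      1# * ⟦ n ⟧ℕ + ⟦ m ⟧ℕ * ⟦ n ⟧ℕ    ≡⟨ sym (distribʳ _ _ _) ⟩
      (1# + ⟦ m ⟧ℕ) * ⟦ n ⟧ℕ           ≡⟨ cong (_* ⟦ n ⟧ℕ) (trans (+-comm _ _) (sym (⟦suc⟧ℕ m))) ⟩
      ⟦ suc m ⟧ℕ * ⟦ n ⟧ℕ              ∎
    where open ≡-Reasoning

  ⟦_⟧ℤ : ℤ → Carrier
  ⟦ ℤ.+ n ⟧ℤ = ⟦ n ⟧ℕ
  ⟦ -[1+ n ] ⟧ℤ = - ⟦ suc n ⟧ℕ

  ⟦⊖⟧ℤ : ∀ m n → ⟦ m ⊖ n ⟧ℤ ≡ ⟦ m ⟧ℕ - ⟦ n ⟧ℕ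
  ⟦⊖⟧ℤ m zero = sym (trans (cong (⟦ m ⟧ℕ +_) -0#≈0#) (+-identityʳ _))
  ⟦⊖⟧ℤ zero (suc n) = sym (+-identityˡ _)
  ⟦⊖⟧ℤ (suc m) (suc n) = begin
      ⟦ suc m ⊖ suc n ⟧ℤ                    ≡⟨ cong ⟦_⟧ℤ (ℤₚ.[1+m]⊖[1+n]≡m⊖n m n) ⟩
      ⟦ m ⊖ n ⟧ℤ                            ≡⟨ ⟦⊖⟧ℤ m n ⟩
      ⟦ m ⟧ℕ + - ⟦ n ⟧ℕ                     ≡⟨ cong (⟦ m ⟧ℕ +_) (sym (+-identityˡ _)) ⟩
      ⟦ m ⟧ℕ + (0# + - ⟦ n ⟧ℕ)              ≡⟨ cong (λ z → ⟦ m ⟧ℕ + (z + - ⟦ n ⟧ℕ)) (sym (-‿inverseʳ 1#)) ⟩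
      ⟦ m ⟧ℕ + ((1# + - 1#) + - ⟦ n ⟧ℕ)     ≡⟨ cong (⟦ m ⟧ℕ +_) (+-assoc _ _ _) ⟩
      ⟦ m ⟧ℕ + (1# + (- 1# + - ⟦ n ⟧ℕ))     ≡⟨ sym (+-assoc _ _ _) ⟩
      ⟦ m ⟧ℕ + 1# + (- 1# + - ⟦ n ⟧ℕ)       ≡⟨ cong₂ _+_ (sym (⟦suc⟧ℕ m)) (sym (-‿anti-homo-+ _ _)) ⟩
      ⟦ suc m ⟧ℕ + - (⟦ n ⟧ℕ + 1#)          ≡⟨ cong (λ z → ⟦ suc m ⟧ℕ - z) (sym (⟦suc⟧ℕ n)) ⟩
      ⟦ suc m ⟧ℕ - ⟦ suc n ⟧ℕ               ∎
    where open ≡-Reasoning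

  ⟦+⟧ℤ : ∀ i j → ⟦ i ℤ.+ j ⟧ℤ ≡ ⟦ i ⟧ℤ + ⟦ j ⟧ℤ
  ⟦+⟧ℤ -[1+ m ] -[1+ n ] = begin
      - ⟦ suc (suc (m ℕ.+ n)) ⟧ℕ           ≡⟨ cong (λ k → - ⟦ suc k ⟧ℕ) (sym (ℕₚ.+-suc m n)) ⟩
      - ⟦ suc m ℕ.+ suc n ⟧ℕ               ≡⟨ cong -_ (trans (⟦+⟧ℕ (suc m) (suc n)) (+-comm _ _)) ⟩
      - (⟦ suc n ⟧ℕ + ⟦ suc m ⟧ℕ)          ≡⟨ -‿anti-homo-+ _ _ ⟩
      - ⟦ suc m ⟧ℕ + - ⟦ suc n ⟧ℕ          ∎
    where open ≡-Reasoning
  ⟦+⟧ℤ -[1+ m ] (ℤ.+ n) = trans (⟦⊖⟧ℤ n (suc m)) (+-comm _ _)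
  ⟦+⟧ℤ (ℤ.+ m) -[1+ n ] = ⟦⊖⟧ℤ m (suc n)
  ⟦+⟧ℤ (ℤ.+ m) (ℤ.+ n) = ⟦+⟧ℕ m n

  ⟦_⟧sign : Sign → Carrier
  ⟦ Sign.+ ⟧sign = 1#
  ⟦ Sign.- ⟧sign = - 1#

  ⟦*⟧sign : ∀ s t → ⟦ s Sign.* t ⟧sign ≡ ⟦ s ⟧sign * ⟦ t ⟧sign
  ⟦*⟧sign Sign.+ t = sym (*-identityˡ _)
  ⟦*⟧sign Sign.- Sign.+ = sym (*-identityʳ _)
  ⟦*⟧sign Sign.- Sign.- = sym (trans (sym (-‿distribˡ-* 1# (- 1#))) (trans (cong -_ (*-identityˡ _)) (-‿involutive 1#)))

  ⟦◃⟧ℤ : ∀ s n → ⟦ s ℤ.◃ n ⟧ℤ ≡ ⟦ s ⟧sign * ⟦ n ⟧ℕ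
  ⟦◃⟧ℤ s zero = sym (zeroʳ _)
  ⟦◃⟧ℤ Sign.+ (suc n) = sym (*-identityˡ _)
  ⟦◃⟧ℤ Sign.- (suc n) = trans (cong -_ (sym (*-identityˡ _))) (-‿distribˡ-* 1# _)

  ⟦sign*abs⟧ℤ : ∀ i → ⟦ i ⟧ℤ ≡ ⟦ ℤ.sign i ⟧sign * ⟦ ℤ.∣ i ∣ ⟧ℕ
  ⟦sign*abs⟧ℤ i = trans (cong ⟦_⟧ℤ (sym (ℤₚ.◃-inverse i))) (⟦◃⟧ℤ (ℤ.sign i) ℤ.∣ i ∣)

  ⟦*⟧ℤ : ∀ i j → ⟦ i ℤ.* j ⟧ℤ ≡ ⟦ i ⟧ℤ * ⟦ j ⟧ℤ
  ⟦*⟧ℤ i j = begin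
      ⟦ i ℤ.* j ⟧ℤ                      ≡⟨ ⟦◃⟧ℤ (ℤ.sign i Sign.* ℤ.sign j) (ℤ.∣ i ∣ ℕ.* ℤ.∣ j ∣) ⟩
      ⟦ si Sign.* sj ⟧sign * ⟦ ai ℕ.* aj ⟧ℕ
        ≡⟨ cong₂ _*_ (⟦*⟧sign si sj) (⟦*⟧ℕ ai aj) ⟩
      (⟦ si ⟧sign * ⟦ sj ⟧sign) * (⟦ ai ⟧ℕ * ⟦ aj ⟧ℕ)
        ≡⟨ interchange ⟦ si ⟧sign ⟦ sj ⟧sign ⟦ ai ⟧ℕ ⟦ aj ⟧ℕ ⟩
      (⟦ si ⟧sign * ⟦ ai ⟧ℕ) * (⟦ sj ⟧sign * ⟦ aj ⟧ℕ)
        ≡⟨ sym (cong₂ _*_ (⟦sign*abs⟧ℤ i) (⟦sign*abs⟧ℤ j)) ⟩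
      ⟦ i ⟧ℤ * ⟦ j ⟧ℤ                   ∎
    where
      open ≡-Reasoning
      si = ℤ.sign i
      sj = ℤ.sign j
      ai = ℤ.∣ i ∣
      aj = ℤ.∣ j ∣
      interchange : ∀ a b c d → (a * b) * (c * d) ≡ (a * c) * (b * d)
      interchange a b c d = begin
        (a * b) * (c * d)  ≡⟨ *-assoc _ _ _ ⟩
        a * (b * (c * d))  ≡⟨ cong (a *_) (trans (sym (*-assoc _ _ _)) (trans (cong (_* d) (*-comm b c)) (*-assoc _ _ _))) ⟩
        a * (c * (b * d))  ≡⟨ sym (*-assoc _ _ _) ⟩
        (a * c) * (b * d)  ∎

  ⟦-⟧ℤ : ∀ i → ⟦ ℤ.- i ⟧ℤ ≡ - ⟦ i ⟧ℤ
  ⟦-⟧ℤ (ℤ.+ zero) = sym -0#≈0#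
  ⟦-⟧ℤ (ℤ.+ suc n) = refl
  ⟦-⟧ℤ -[1+ n ] = sym (-‿involutive _)

  ℤ⟶𝔽 : ℤ.+-*-rawRing ACR.-Raw-AlmostCommutative⟶ ACR.fromCommutativeRing commutativeRing
  ℤ⟶𝔽 = record
    { ⟦_⟧ = ⟦_⟧ℤ ; +-homo = ⟦+⟧ℤ ; *-homo = ⟦*⟧ℤ ; -‿homo = ⟦-⟧ℤ ; 0-homo = refl ; 1-homo = refl }

  ℤ-coefficients-equal? : ∀ i j → Maybe (⟦ i ⟧ℤ ≡ ⟦ j ⟧ℤ)
  ℤ-coefficients-equal? i j with i ℤ.≟ j
  ... | yes refl = just refl
  ... | no _ = nothing

  open import Algebra.Solver.Ring ℤ.+-*-rawRing (ACR.fromCommutativeRing commutativeRing) ℤ⟶𝔽 ℤ-coefficients-equal? public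
    using (solve; _:=_; _:+_; _:*_; _:-_; :-_; con; Polynomial)

  c0 c1 c2 c3 : ∀ {n} → Polynomial n
  c0 = con (ℤ.+ 0)
  c1 = con (ℤ.+ 1)
  c2 = con (ℤ.+ 2)
  c3 = con (ℤ.+ 3)

  1≢0 : ¬ 1# ≡ 0#
  1≢0 = ≢-sym 0≢1

  ⁻¹-inverseˡ : ∀ {x} → ¬ x ≡ 0# → x ⁻¹ * x ≡ 1#
  ⁻¹-inverseˡ {x} x≢0 = trans (*-comm _ _) (⁻¹-inverse x x≢0)

  *-cancelˡ : ∀ {a b c} → ¬ a ≡ 0# → a * b ≡ a * c → b ≡ c
  *-cancelˡ {a} {b} {c} a≢0 ab≡ac = begin
      b                ≡⟨ sym (*-identityˡ b) ⟩
      1# * b           ≡⟨ cong (_* b) (sym (⁻¹-inverseˡ a≢0)) ⟩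
      a ⁻¹ * a * b     ≡⟨ *-assoc _ _ _ ⟩
      a ⁻¹ * (a * b)   ≡⟨ cong (a ⁻¹ *_) ab≡ac ⟩
      a ⁻¹ * (a * c)   ≡⟨ sym (*-assoc _ _ _) ⟩
      a ⁻¹ * a * c     ≡⟨ cong (_* c) (⁻¹-inverseˡ a≢0) ⟩
      1# * c           ≡⟨ *-identityˡ c ⟩
      c                ∎
    where open ≡-Reasoning

  x*y≡0∧x≢0⇒y≡0 : ∀ {x y} → x * y ≡ 0# → ¬ x ≡ 0# → y ≡ 0#
  x*y≡0∧x≢0⇒y≡0 {x} {y} xy≡0 x≢0 = *-cancelˡ x≢0 (trans xy≡0 (sym (zeroʳ x)))

  x*y≡0∧y≢0⇒x≡0 : ∀ {x y} → x * y ≡ 0# → ¬ y ≡ 0# → x ≡ 0#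
  x*y≡0∧y≢0⇒x≡0 xy≡0 = x*y≡0∧x≢0⇒y≡0 (trans (*-comm _ _) xy≡0)

  x*y≡0⇒x≡0⊎y≡0 : ∀ {x y} → x * y ≡ 0# → x ≡ 0# ⊎ y ≡ 0#
  x*y≡0⇒x≡0⊎y≡0 {x} xy≡0 with x ≟ 0#
  ... | yes x≡0 = inj₁ x≡0
  ... | no x≢0 = inj₂ (x*y≡0∧x≢0⇒y≡0 xy≡0 x≢0)

  x*y*z≡0⇒ : ∀ {x y z} → x * y * z ≡ 0# → x ≡ 0# ⊎ y ≡ 0# ⊎ z ≡ 0#
  x*y*z≡0⇒ {x} {y} {z} xyz≡0 with z ≟ 0# | y ≟ 0#
  ... | yes z≡0 | _ = inj₂ (inj₂ z≡0)
  ... | no _ | yes y≡0 = inj₂ (inj₁ y≡0)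
  ... | no z≢0 | no y≢0 = inj₁ (x*y≡0∧y≢0⇒x≡0 (x*y≡0∧y≢0⇒x≡0 xyz≡0 z≢0) y≢0)

  *-≢0 : ∀ {x y} → ¬ x ≡ 0# → ¬ y ≡ 0# → ¬ x * y ≡ 0#
  *-≢0 x≢0 y≢0 xy≡0 = y≢0 (x*y≡0∧x≢0⇒y≡0 xy≡0 x≢0)

  ⁻¹-≢0 : ∀ {x} → ¬ x ≡ 0# → ¬ x ⁻¹ ≡ 0#
  ⁻¹-≢0 {x} x≢0 x⁻¹≡0 = 1≢0 (trans (sym (⁻¹-inverse x x≢0)) (trans (cong (x *_) x⁻¹≡0) (zeroʳ x)))

  -‿≢0 : ∀ {x} → ¬ x ≡ 0# → ¬ - x ≡ 0#
  -‿≢0 {x} x≢0 -x≡0 = x≢0 (trans (sym (-‿involutive x)) (trans (cong -_ -x≡0) -0#≈0#))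

  cube-≢0 : ∀ {x} → ¬ x ≡ 0# → ¬ cube x ≡ 0#
  cube-≢0 x≢0 = *-≢0 (*-≢0 x≢0 x≢0) x≢0

  cube≡0⇒x≡0 : ∀ {x} → cube x ≡ 0# → x ≡ 0#
  cube≡0⇒x≡0 {x} x³≡0 with x ≟ 0#
  ... | yes x≡0 = x≡0
  ... | no x≢0 = ⊥-elim (cube-≢0 x≢0 x³≡0)

  cube-0 : cube 0# ≡ 0#
  cube-0 = zeroʳ _

  x≡k*y⇒y≡k⁻¹*x : ∀ {x y k} → ¬ k ≡ 0# → x ≡ k * y → y ≡ k ⁻¹ * x
  x≡k*y⇒y≡k⁻¹*x {x} {y} {k} k≢0 x≡ky = *-cancelˡ k≢0 (begin
      k * y               ≡⟨ sym x≡ky ⟩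
      x                   ≡⟨ sym (*-identityˡ x) ⟩
      1# * x              ≡⟨ cong (_* x) (sym (⁻¹-inverse k k≢0)) ⟩
      k * k ⁻¹ * x        ≡⟨ *-assoc _ _ _ ⟩
      k * (k ⁻¹ * x)      ∎)
    where open ≡-Reasoning

module Cubes (𝔽 : FiniteField) where

  open FieldArithmetic 𝔽
  open DecidableLists _≟_

  IsCube : Carrier → Set
  IsCube c = Σ Carrier λ w → cube w ≡ c

  isCube? : Decidable IsCube
  isCube? c with Any.any? (λ w → cube w ≟ c) elements
  ... | yes w∈ = yes (Any.satisfied w∈)
  ... | no ¬w∈ = no (λ (w , w³≡c) → ¬w∈ (lose (elements-complete w) w³≡c))

  F* : List Carrier
  F* = elements without 0#

  ∈-F* : ∀ {x} → ¬ x ≡ 0# → x ∈ F*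
  ∈-F* {x} x≢0 = ∈-without⁺ (elements-complete x) x≢0

  F*-≢0 : ∀ {x} → x ∈ F* → ¬ x ≡ 0#
  F*-≢0 x∈ = proj₂ (∈-without⁻ elements x∈)

  F*-unique : Unique F*
  F*-unique = without-unique elements-unique

  1+length-F* : suc (length F*) ≡ card
  1+length-F* = length-without elements-unique (elements-complete 0#)

  nonzero-count : CountMod _≡_ (λ x → ¬ x ≡ 0#) (card ℕ.∸ 1)
  nonzero-count = F* , cong (ℕ._∸ 1) 1+length-F* , All.tabulate F*-≢0 , F*-unique , λ x x≢0 → ∈-F* x≢0

  3#≢0 : ¬ card ℕ.% 3 ≡ 0 → ¬ 3# ≡ 0#
  3#≢0 q%3≢0 3#≡0 = Residues.q%3≢0⇒3k≢q card (length (Transversal.reps T)) q%3≢0 (Transversal.3*length-reps T)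
    where
      +1-cubed : ∀ {x} → ⊤ → x + 1# + 1# + 1# ≡ x
      +1-cubed {x} _ = trans (solve 1 (λ x → x :+ c1 :+ c1 :+ c1 := x :+ c3) refl x) (trans (cong (x +_) 3#≡0) (+-identityʳ x))
      +1-fixpoint-free : ∀ {x} → ⊤ → ¬ x + 1# ≡ x
      +1-fixpoint-free {x} _ x+1≡x = 1≢0 (trans (solve 1 (λ x → c1 := (x :+ c1) :- x) refl x) (x≡y⇒x-y≡0 x+1≡x))
      open TripleOrbits (λ _ → ⊤) (_+ 1#) _ +1-cubed +1-fixpoint-free
      T = transversal elements elements-unique _ (λ {x} _ → elements-complete (x + 1#))

  NotZeroOne : Carrier → Set
  NotZeroOne x = ¬ x ≡ 0# × ¬ x ≡ 1#

  F** : List Carrier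
  F** = F* without 1#

  ∈-F** : ∀ {x} → NotZeroOne x → x ∈ F**
  ∈-F** (x≢0 , x≢1) = ∈-without⁺ (∈-F* x≢0) x≢1

  F**-≢0,1 : ∀ {x} → x ∈ F** → NotZeroOne x
  F**-≢0,1 x∈ = F*-≢0 (proj₁ (∈-without⁻ F* x∈)) , proj₂ (∈-without⁻ F* x∈)

  2+length-F** : suc (suc (length F**)) ≡ card
  2+length-F** = trans (cong suc (length-without F*-unique (∈-F* 1≢0))) 1+length-F*

  element-≢0,1 : card ℕ.% 2 ≡ 1 → Σ Carrier NotZeroOne
  element-≢0,1 q-odd = first F** refl
    where
      first : ∀ xs → xs ≡ F** → Σ Carrier NotZeroOne
      first [] []≡F** with trans (cong (λ xs → suc (suc (length xs)) ℕ.% 2) []≡F**) (trans (cong (ℕ._% 2) 2+length-F**) q-odd)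
      ... | ()
      first (x ∷ _) x∷≡F** = x , F**-≢0,1 (subst (x ∈_) x∷≡F** (here refl))

  module OneMinusInverse where

    σ : Carrier → Carrier
    σ x = (1# - x) ⁻¹

    1-x≢0 : ∀ {x} → ¬ x ≡ 1# → ¬ 1# - x ≡ 0#
    1-x≢0 x≢1 1-x≡0 = x≢1 (sym (x-y≡0⇒x≡y _ _ 1-x≡0))

    σx*[1-x]≡1 : ∀ {x} → ¬ x ≡ 1# → σ x * (1# - x) ≡ 1#
    σx*[1-x]≡1 x≢1 = ⁻¹-inverseˡ (1-x≢0 x≢1)

    σ-good : ∀ {x} → NotZeroOne x → NotZeroOne (σ x)
    σ-good {x} (x≢0 , x≢1) = ⁻¹-≢0 (1-x≢0 x≢1) , λ σx≡1 → x≢0 (begin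
        x                                          ≡⟨ solve 2 (λ x s → x := c1 :- (s :* (c1 :- x)) :+ (s :- c1) :* (c1 :- x)) refl x (σ x) ⟩
        1# - σ x * (1# - x) + (σ x - 1#) * (1# - x)  ≡⟨ cong₂ (λ a b → 1# - a + (b - 1#) * (1# - x)) (σx*[1-x]≡1 x≢1) σx≡1 ⟩
        1# - 1# + (1# - 1#) * (1# - x)              ≡⟨ solve 1 (λ x → c1 :- c1 :+ (c1 :- c1) :* (c1 :- x) := c0) refl x ⟩
        0#                                         ∎)
      where open ≡-Reasoning

    σ³≡id : ∀ {x} → NotZeroOne x → σ (σ (σ x)) ≡ x
    σ³≡id {x} good@(_ , x≢1) = *-cancelˡ (1-x≢0 b≢1) (trans (*-comm _ _) (trans (σx*[1-x]≡1 b≢1) (trans (sym x[1-b]≡1) (*-comm _ _))))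
      where
        a = σ x
        b = σ a
        a-good = σ-good good
        b≢1 = proj₂ (σ-good a-good)
        x[1-b]-1≡0 : a * (x * (1# - b) - 1#) ≡ 0#
        x[1-b]-1≡0 = begin
          a * (x * (1# - b) - 1#)                               ≡⟨ solve 3 (λ x a b → a :* (x :* (c1 :- b) :- c1) := (b :* (c1 :- a) :- c1) :- (a :* (c1 :- x) :- c1) :* (c1 :- b)) refl x a b ⟩
          (b * (1# - a) - 1#) - (a * (1# - x) - 1#) * (1# - b)  ≡⟨ cong₂ (λ u v → u - v * (1# - b)) (x≡y⇒x-y≡0 (σx*[1-x]≡1 (proj₂ a-good))) (x≡y⇒x-y≡0 (σx*[1-x]≡1 x≢1)) ⟩
          0# - 0# * (1# - b)                                    ≡⟨ solve 1 (λ b → c0 :- c0 :* (c1 :- b) := c0) refl b ⟩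
          0#                                                    ∎
          where open ≡-Reasoning
        x[1-b]≡1 : x * (1# - b) ≡ 1#
        x[1-b]≡1 = x-y≡0⇒x≡y _ _ (x*y≡0∧x≢0⇒y≡0 x[1-b]-1≡0 (proj₁ a-good))

    σx≡x⇒[-x]²+[-x]+1≡0 : ∀ {x} → ¬ x ≡ 1# → σ x ≡ x → (- x) * (- x) + (- x) + 1# ≡ 0#
    σx≡x⇒[-x]²+[-x]+1≡0 {x} x≢1 σx≡x = begin
      (- x) * (- x) + (- x) + 1#   ≡⟨ solve 1 (λ x → (:- x) :* (:- x) :+ (:- x) :+ c1 := :- (x :* (c1 :- x) :- c1)) refl x ⟩
      - (x * (1# - x) - 1#)        ≡⟨ cong -_ (x≡y⇒x-y≡0 (trans (cong (_* (1# - x)) (sym σx≡x)) (σx*[1-x]≡1 x≢1))) ⟩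
      - 0#                         ≡⟨ -0#≈0# ⟩
      0#                           ∎
      where open ≡-Reasoning

  -- A fixed point of x ↦ (1 - x)⁻¹, of order 3 on F ∖ {0, 1}, gives the root; without one, 3 would divide q - 2.
  cubeRootOfUnity : card ℕ.% 6 ≡ 1 → Σ Carrier λ ω → ω * ω + ω + 1# ≡ 0#
  cubeRootOfUnity q%6≡1 = fromFixpoint (Any.any? (λ x → σ x ≟ x) F**)
    where
      open OneMinusInverse
      fromFixpoint : Dec (Any (λ x → σ x ≡ x) F**) → Σ Carrier λ ω → ω * ω + ω + 1# ≡ 0#
      fromFixpoint (yes fixpoint) with find fixpoint
      ... | x , x∈F** , σx≡x = - x , σx≡x⇒[-x]²+[-x]+1≡0 (proj₂ (F**-≢0,1 x∈F**)) σx≡x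
      fromFixpoint (no no-fixpoint) =
        ⊥-elim (Residues.q%6≡1⇒2+3k≢q card (length (Transversal.reps T)) q%6≡1 (trans (cong (λ n → suc (suc n)) (Transversal.3*length-reps T)) 2+length-F**))
        where
          open TripleOrbits NotZeroOne σ σ-good σ³≡id (λ good σx≡x → no-fixpoint (lose (∈-F** good) σx≡x))
          T = transversal F** (without-unique F*-unique) F**-≢0,1 (λ x∈F** → ∈-F** (σ-good (F**-≢0,1 x∈F**)))

  module CubeRootOfUnity (3≢0 : ¬ 3# ≡ 0#) (ω : Carrier) (ω²+ω+1≡0 : ω * ω + ω + 1# ≡ 0#) where

    ω³≡1 : cube ω ≡ 1#
    ω³≡1 = begin
      cube ω                                ≡⟨ solve 1 (λ ω → ω :* ω :* ω := c1 :+ (ω :- c1) :* (ω :* ω :+ ω :+ c1)) refl ω ⟩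
      1# + (ω - 1#) * (ω * ω + ω + 1#)      ≡⟨ cong (λ z → 1# + (ω - 1#) * z) ω²+ω+1≡0 ⟩
      1# + (ω - 1#) * 0#                    ≡⟨ solve 1 (λ ω → c1 :+ (ω :- c1) :* c0 := c1) refl ω ⟩
      1#                                    ∎
      where open ≡-Reasoning

    ω≢0 : ¬ ω ≡ 0#
    ω≢0 ω≡0 = 1≢0 (trans (solve 0 (c1 := c0 :* c0 :+ c0 :+ c1) refl) (trans (cong (λ z → z * z + z + 1#) (sym ω≡0)) ω²+ω+1≡0))

    ω≢1 : ¬ ω ≡ 1#
    ω≢1 ω≡1 = 3≢0 (trans (solve 0 (c3 := c1 :* c1 :+ c1 :+ c1) refl) (trans (cong (λ z → z * z + z + 1#) (sym ω≡1)) ω²+ω+1≡0))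

    cube-ω* : ∀ r → cube (ω * r) ≡ cube r
    cube-ω* r = begin
      cube (ω * r)          ≡⟨ solve 2 (λ ω r → (ω :* r) :* (ω :* r) :* (ω :* r) := (ω :* ω :* ω) :* (r :* r :* r)) refl ω r ⟩
      cube ω * cube r       ≡⟨ cong (_* cube r) ω³≡1 ⟩
      1# * cube r           ≡⟨ *-identityˡ _ ⟩
      cube r                ∎
      where open ≡-Reasoning

    -- w³ - r³ = (w - r)(w - ωr)(w - ω²r) + (ω² + ω + 1)·(polynomial in w, r, ω)
    cube≡cube⇒ : ∀ {w r} → cube w ≡ cube r → w ≡ r ⊎ w ≡ ω * r ⊎ w ≡ ω * (ω * r)
    cube≡cube⇒ {w} {r} w³≡r³ with x*y≡0⇒x≡0⊎y≡0 factored≡0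
      where
        factored≡0 : (w - r) * (w - ω * r) * (w - ω * (ω * r)) ≡ 0#
        factored≡0 = begin
          (w - r) * (w - ω * r) * (w - ω * (ω * r))
            ≡⟨ solve 3 (λ w r ω → (w :- r) :* (w :- ω :* r) :* (w :- ω :* (ω :* r))
                   := (w :* w :* w :- r :* r :* r) :- (ω :* ω :+ ω :+ c1) :* (r :* w :* w :- ω :* r :* r :* w :+ (ω :- c1) :* r :* r :* r))
                 refl w r ω ⟩
          (cube w - cube r) - (ω * ω + ω + 1#) * K   ≡⟨ cong₂ (λ a b → a - b * K) (x≡y⇒x-y≡0 w³≡r³) ω²+ω+1≡0 ⟩
          0# - 0# * K                                ≡⟨ solve 1 (λ k → c0 :- c0 :* k := c0) refl K ⟩
          0#                                         ∎
          where
            open ≡-Reasoning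
            K = r * w * w - ω * r * r * w + (ω - 1#) * r * r * r
    ... | inj₂ third≡0 = inj₂ (inj₂ (x-y≡0⇒x≡y _ _ third≡0))
    ... | inj₁ first-two≡0 with x*y≡0⇒x≡0⊎y≡0 first-two≡0
    ...   | inj₁ first≡0 = inj₁ (x-y≡0⇒x≡y _ _ first≡0)
    ...   | inj₂ second≡0 = inj₂ (inj₁ (x-y≡0⇒x≡y _ _ second≡0))

    ω*-cubed : ∀ {x} → ¬ x ≡ 0# → ω * (ω * (ω * x)) ≡ x
    ω*-cubed {x} _ = trans (solve 2 (λ ω x → ω :* (ω :* (ω :* x)) := (ω :* ω :* ω) :* x) refl ω x)
                           (trans (cong (_* x) ω³≡1) (*-identityˡ x))

    ω*-fixpoint-free : ∀ {x} → ¬ x ≡ 0# → ¬ ω * x ≡ x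
    ω*-fixpoint-free {x} x≢0 ωx≡x =
      ω≢1 (x-y≡0⇒x≡y _ _ (x*y≡0∧y≢0⇒x≡0 (trans (solve 2 (λ ω x → (ω :- c1) :* x := ω :* x :- x) refl ω x) (x≡y⇒x-y≡0 ωx≡x)) x≢0))

    open TripleOrbits (λ x → ¬ x ≡ 0#) (ω *_) (*-≢0 ω≢0) ω*-cubed ω*-fixpoint-free public

    ω-orbits : Transversal F*
    ω-orbits = transversal F* F*-unique F*-≢0 (λ x∈ → ∈-F* (*-≢0 ω≢0 (F*-≢0 x∈)))

    open Transversal ω-orbits public

    1+3*length-reps : suc (3 ℕ.* length reps) ≡ card
    1+3*length-reps = trans (cong suc 3*length-reps) 1+length-F*

    InOrbitOf⇒cube≡ : ∀ {r w} → InOrbitOf r w → cube w ≡ cube r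
    InOrbitOf⇒cube≡ (inj₁ refl) = refl
    InOrbitOf⇒cube≡ {r} (inj₂ (inj₁ refl)) = cube-ω* r
    InOrbitOf⇒cube≡ {r} (inj₂ (inj₂ refl)) = trans (cube-ω* (ω * r)) (cube-ω* r)


    cube-root-count : ∀ {c} → ¬ c ≡ 0# → IsCube c → CountMod _≡_ (λ w → cube w ≡ c) 3
    cube-root-count {c} c≢0 (r , r³≡c) =
        (r ∷ ω * r ∷ ω * (ω * r) ∷ []) , refl ,
        (r³≡c ∷ trans (cube-ω* r) r³≡c ∷ trans (cube-ω* (ω * r)) (trans (cube-ω* r) r³≡c) ∷ []) ,
        ((r≢ωr ∷ r≢ω²r ∷ []) ∷ (ωr≢ω²r ∷ []) ∷ [] ∷ []) , cover
      where
        r≢0 : ¬ r ≡ 0#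
        r≢0 r≡0 = c≢0 (trans (sym r³≡c) (trans (cong cube r≡0) cube-0))
        r≢ωr : ¬ r ≡ ω * r
        r≢ωr r≡ωr = ω*-fixpoint-free r≢0 (sym r≡ωr)
        r≢ω²r : ¬ r ≡ ω * (ω * r)
        r≢ω²r r≡ω²r = ω*-fixpoint-free r≢0 (trans (cong (ω *_) r≡ω²r) (ω*-cubed r≢0))
        ωr≢ω²r : ¬ ω * r ≡ ω * (ω * r)
        ωr≢ω²r ωr≡ω²r = ω*-fixpoint-free (*-≢0 ω≢0 r≢0) (sym ωr≡ω²r)
        cover : ∀ w → cube w ≡ c → w ∈ r ∷ ω * r ∷ ω * (ω * r) ∷ []
        cover w w³≡c with cube≡cube⇒ (trans w³≡c (sym r³≡c))
        ... | inj₁ w≡r = here w≡r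
        ... | inj₂ (inj₁ w≡ωr) = there (here w≡ωr)
        ... | inj₂ (inj₂ w≡ω²r) = there (there (here w≡ω²r))

    nonzero-cube-count : CountMod _≡_ (λ c → ¬ c ≡ 0# × IsCube c) ((card ℕ.∸ 1) ℕ./ 3)
    nonzero-cube-count =
        map cube reps , trans (length-map cube reps) (sym (Residues.1+3r≡q⇒[q∸1]/3≡r card (length reps) 1+3*length-reps)) ,
        Allₚ.map⁺ (All.map (λ {r} r∈ → cube-≢0 (F*-≢0 r∈) , r , refl) reps⊆L) ,
        AllPairsₚ.map⁺ (AllPairs.map (λ r∉orbit r³≡r'³ → r∉orbit (cube≡cube⇒ (sym r³≡r'³))) disjoint) ,
        cover
      where
        cover : ∀ c → ¬ c ≡ 0# × IsCube c → c ∈ map cube reps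
        cover c (c≢0 , w , w³≡c) = Anyₚ.map⁺ (Any.map (λ w∈orbit → trans (sym w³≡c) (InOrbitOf⇒cube≡ w∈orbit)) (covers (∈-F* w≢0)))
          where
            w≢0 : ¬ w ≡ 0#
            w≢0 w≡0 = c≢0 (trans (sym w³≡c) (trans (cong cube w≡0) cube-0))

    nonzero-noncube-count : CountMod _≡_ (λ c → ¬ c ≡ 0# × ¬ IsCube c) (2 ℕ.* ((card ℕ.∸ 1) ℕ./ 3))
    nonzero-noncube-count = subst (CountMod _≡_ _) |noncubes|≡ (filter-countMod (∁? isCube?) F* F*-unique F*-≢0 ∈-F*)
      where
        cubes = filter isCube? F*
        noncubes = filter (∁? isCube?) F*
        |cubes|≡|reps| : length cubes ≡ length reps
        |cubes|≡|reps| = trans (countMod≡-unique (filter-countMod isCube? F* F*-unique F*-≢0 ∈-F*) nonzero-cube-count (λ x → x) (λ x → x))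
                               (Residues.1+3r≡q⇒[q∸1]/3≡r card (length reps) 1+3*length-reps)
        |noncubes|≡ : length noncubes ≡ 2 ℕ.* ((card ℕ.∸ 1) ℕ./ 3)
        |noncubes|≡ = Residues.1+3r≡q∧r+n≡q∸1⇒n≡2[q∸1]/3 card (length reps) (length noncubes) 1+3*length-reps
          (trans (cong (ℕ._+ length noncubes) (sym |cubes|≡|reps|))
            (trans (length-filter+length-filter-∁ isCube? F*) (cong (ℕ._∸ 1) 1+length-F*)))

  module WhenQ≡5Mod6 (q%3≢0 : ¬ card ℕ.% 3 ≡ 0) (q%6≡5 : card ℕ.% 6 ≡ 5) where

    no-cube-root-of-unity : ∀ ω → ¬ ω * ω + ω + 1# ≡ 0#
    no-cube-root-of-unity ω ω²+ω+1≡0 = Residues.q%6≡5⇒1+3k≢q card (length reps) q%6≡5 1+3*length-reps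
      where open CubeRootOfUnity (3#≢0 q%3≢0) ω ω²+ω+1≡0

    -- x³ - y³ = (x - y)(x² + xy + y²), and x² + xy + y² = 0 with y ≠ 0 makes x/y a cube root of unity.
    cube-injective : ∀ {x y} → cube x ≡ cube y → x ≡ y
    cube-injective {x} {y} x³≡y³ with y ≟ 0#
    ... | yes y≡0 = trans (cube≡0⇒x≡0 (trans x³≡y³ (trans (cong cube y≡0) cube-0))) (sym y≡0)
    ... | no y≢0 with x*y≡0⇒x≡0⊎y≡0 (trans (solve 2 (λ x y → (x :- y) :* (x :* x :+ x :* y :+ y :* y) := x :* x :* x :- y :* y :* y) refl x y) (x≡y⇒x-y≡0 x³≡y³))
    ...   | inj₁ x-y≡0 = x-y≡0⇒x≡y _ _ x-y≡0
    ...   | inj₂ x²+xy+y²≡0 = ⊥-elim (no-cube-root-of-unity (x * y ⁻¹) (begin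
            (x * i) * (x * i) + x * i + 1#                                      ≡⟨ solve 3 (λ x y i → (x :* i) :* (x :* i) :+ x :* i :+ c1 := (i :* i) :* (x :* x :+ x :* y :+ y :* y) :+ (c1 :- i :* y) :* (x :* i :+ c1 :+ i :* y)) refl x y i ⟩
            (i * i) * (x * x + x * y + y * y) + (1# - i * y) * (x * i + 1# + i * y)  ≡⟨ cong₂ (λ a b → (i * i) * a + b * (x * i + 1# + i * y)) x²+xy+y²≡0 (x≡y⇒x-y≡0 (sym (⁻¹-inverseˡ y≢0))) ⟩
            (i * i) * 0# + 0# * (x * i + 1# + i * y)                            ≡⟨ solve 2 (λ a b → a :* c0 :+ c0 :* b := c0) refl (i * i) (x * i + 1# + i * y) ⟩
            0#                                                                  ∎))
      where
        open ≡-Reasoning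
        i = y ⁻¹

    cube-surjective : ∀ c → IsCube c
    cube-surjective c with Any.any? (c ≟_) (map cube elements)
    ... | yes c∈cubes = let (w , _ , c≡w³) = ∈-map⁻ cube c∈cubes in w , sym c≡w³
    ... | no c∉cubes = ⊥-elim (ℕₚ.<-irrefl (length-map cube elements) q<q)
      where
        q<q : suc (length (map cube elements)) ≤ length elements
        q<q = unique-⊆⇒length≤ (c ∷ map cube elements) elements
                (Allₚ.¬Any⇒All¬ _ c∉cubes ∷ Uniqueₚ.map⁺ cube-injective elements-unique) (λ {z} _ → elements-complete z)

    cube-root-count : ∀ c → CountMod _≡_ (λ w → cube w ≡ c) 1
    cube-root-count c with cube-surjective c
    ... | w , w³≡c = (w ∷ []) , refl , (w³≡c ∷ []) , ([] ∷ []) , λ v v³≡c → here (cube-injective (trans v³≡c (sym w³≡c)))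

module BinaryForms (𝔽 : FiniteField) where

  open FieldArithmetic 𝔽 public
  open Geometry 𝔽 public hiding (F; 2#; 3#; cube)

  vec≡ : ∀ {a b c d a' b' c' d' : Carrier} → a ≡ a' → b ≡ b' → c ≡ c' → d ≡ d' →
         _≡_ {A = V} (a ∷ b ∷ c ∷ d ∷ []) (a' ∷ b' ∷ c' ∷ d' ∷ [])
  vec≡ refl refl refl refl = refl

  F² : Set
  F² = Carrier × Carrier

  NonzeroPair : F² → Set
  NonzeroPair (x₀ , x₁) = ¬ (x₀ ≡ 0# × x₁ ≡ 0#)

  infixl 7 _·₂_
  _·₂_ : Carrier → F² → F²
  k ·₂ (x₀ , x₁) = k * x₀ , k * x₁

  infixl 6 _+₂_ _-₂_
  _+₂_ _-₂_ : F² → F² → F²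
  (x₀ , x₁) +₂ (y₀ , y₁) = x₀ + y₀ , x₁ + y₁
  (x₀ , x₁) -₂ (y₀ , y₁) = x₀ - y₀ , x₁ - y₁

  det₂ : F² → F² → Carrier
  det₂ (x₀ , x₁) (y₀ , y₁) = x₀ * y₁ - x₁ * y₀

  homog : Param → F²
  homog (just t) = 1# , t
  homog nothing = 0# , 1#

  -- The tangent vector T u is the image of homog′ u under the derivative of ν at homog u.
  homog′ : Param → F²
  homog′ (just t) = 0# , 1#
  homog′ nothing = 1# , 0#

  ν : F² → V
  ν (x₀ , x₁) = x₀ * x₀ * x₀ ∷ x₀ * x₀ * x₁ ∷ x₀ * x₁ * x₁ ∷ x₁ * x₁ * x₁ ∷ []

  -- The x²y-coefficient of ν (x σ + y τ).
  ν-polar : F² → F² → V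
  ν-polar (a₀ , a₁) (b₀ , b₁) =
    3# * (a₀ * a₀ * b₀) ∷ a₀ * a₀ * b₁ + 2# * (a₀ * a₁ * b₀) ∷ 2# * (a₀ * a₁ * b₁) + a₁ * a₁ * b₀ ∷ 3# * (a₁ * a₁ * b₁) ∷ []

  planeThrough : F² → F² → F² → V
  planeThrough (a₀ , a₁) (b₀ , b₁) (c₀ , c₁) =
      a₁ * b₁ * c₁
    ∷ - (a₀ * b₁ * c₁ + a₁ * b₀ * c₁ + a₁ * b₁ * c₀)
    ∷ a₀ * b₀ * c₁ + a₀ * b₁ * c₀ + a₁ * b₀ * c₀
    ∷ - (a₀ * b₀ * c₀)
    ∷ []

  Π-sign : Param → Carrier
  Π-sign (just _) = 1#
  Π-sign nothing = - 1#

  Π-sign-≢0 : ∀ u → ¬ Π-sign u ≡ 0#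
  Π-sign-≢0 (just _) = 1≢0
  Π-sign-≢0 nothing = -‿≢0 1≢0

  P≡ν∘homog : ∀ u → P u ≡ ν (homog u)
  P≡ν∘homog (just t) = vec≡ (solve 0 (c1 := c1 :* c1 :* c1) refl) (solve 1 (λ t → t := c1 :* c1 :* t) refl t)
                            (solve 1 (λ t → t :* t := c1 :* t :* t) refl t) refl
  P≡ν∘homog nothing = vec≡ (sym cube-0) (solve 0 (c0 := c0 :* c0 :* c1) refl)
                           (solve 0 (c0 := c0 :* c1 :* c1) refl) (solve 0 (c1 := c1 :* c1 :* c1) refl)

  dot-planeThrough-ν : ∀ a b c v → dot (planeThrough a b c) (ν v) ≡ det₂ v a * det₂ v b * det₂ v c
  dot-planeThrough-ν (a₀ , a₁) (b₀ , b₁) (c₀ , c₁) (v₀ , v₁) = solve 8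
    (λ a₀ a₁ b₀ b₁ c₀ c₁ v₀ v₁ →
        a₁ :* b₁ :* c₁ :* (v₀ :* v₀ :* v₀)
      :+ (:- (a₀ :* b₁ :* c₁ :+ a₁ :* b₀ :* c₁ :+ a₁ :* b₁ :* c₀)) :* (v₀ :* v₀ :* v₁)
      :+ (a₀ :* b₀ :* c₁ :+ a₀ :* b₁ :* c₀ :+ a₁ :* b₀ :* c₀) :* (v₀ :* v₁ :* v₁)
      :+ (:- (a₀ :* b₀ :* c₀)) :* (v₁ :* v₁ :* v₁)
      := (v₀ :* a₁ :- v₁ :* a₀) :* (v₀ :* b₁ :- v₁ :* b₀) :* (v₀ :* c₁ :- v₁ :* c₀)) refl a₀ a₁ b₀ b₁ c₀ c₁ v₀ v₁

  dot-Π-ν : ∀ u v → dot (Π u) (ν v) ≡ Π-sign u * cube (det₂ (homog u) v)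
  dot-Π-ν (just t) (v₀ , v₁) = solve 3 (λ t v₀ v₁ →
       (:- (t :* t :* t)) :* (v₀ :* v₀ :* v₀) :+ (c3 :* (t :* t)) :* (v₀ :* v₀ :* v₁) :+ (:- (c3 :* t)) :* (v₀ :* v₁ :* v₁) :+ c1 :* (v₁ :* v₁ :* v₁)
    := c1 :* ((c1 :* v₁ :- t :* v₀) :* (c1 :* v₁ :- t :* v₀) :* (c1 :* v₁ :- t :* v₀))) refl t v₀ v₁
  dot-Π-ν nothing (v₀ , v₁) = solve 2 (λ v₀ v₁ →
       c1 :* (v₀ :* v₀ :* v₀) :+ c0 :* (v₀ :* v₀ :* v₁) :+ c0 :* (v₀ :* v₁ :* v₁) :+ c0 :* (v₁ :* v₁ :* v₁)
    := (:- c1) :* ((c0 :* v₁ :- c1 :* v₀) :* (c0 :* v₁ :- c1 :* v₀) :* (c0 :* v₁ :- c1 :* v₀))) refl v₀ v₁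

  dot-planeThrough-T : ∀ u a b c → dot (planeThrough a b c) (T u) ≡
    det₂ (homog′ u) a * det₂ (homog u) b * det₂ (homog u) c + det₂ (homog u) a * det₂ (homog′ u) b * det₂ (homog u) c
    + det₂ (homog u) a * det₂ (homog u) b * det₂ (homog′ u) c
  dot-planeThrough-T (just t) (a₀ , a₁) (b₀ , b₁) (c₀ , c₁) = solve 7 (λ t a₀ a₁ b₀ b₁ c₀ c₁ →
        a₁ :* b₁ :* c₁ :* c0
      :+ (:- (a₀ :* b₁ :* c₁ :+ a₁ :* b₀ :* c₁ :+ a₁ :* b₁ :* c₀)) :* c1
      :+ (a₀ :* b₀ :* c₁ :+ a₀ :* b₁ :* c₀ :+ a₁ :* b₀ :* c₀) :* (c2 :* t)
      :+ (:- (a₀ :* b₀ :* c₀)) :* (c3 :* (t :* t))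
      := (c0 :* a₁ :- c1 :* a₀) :* (c1 :* b₁ :- t :* b₀) :* (c1 :* c₁ :- t :* c₀)
       :+ (c1 :* a₁ :- t :* a₀) :* (c0 :* b₁ :- c1 :* b₀) :* (c1 :* c₁ :- t :* c₀)
       :+ (c1 :* a₁ :- t :* a₀) :* (c1 :* b₁ :- t :* b₀) :* (c0 :* c₁ :- c1 :* c₀)) refl t a₀ a₁ b₀ b₁ c₀ c₁
  dot-planeThrough-T nothing (a₀ , a₁) (b₀ , b₁) (c₀ , c₁) = solve 6 (λ a₀ a₁ b₀ b₁ c₀ c₁ →
        a₁ :* b₁ :* c₁ :* c0
      :+ (:- (a₀ :* b₁ :* c₁ :+ a₁ :* b₀ :* c₁ :+ a₁ :* b₁ :* c₀)) :* c0
      :+ (a₀ :* b₀ :* c₁ :+ a₀ :* b₁ :* c₀ :+ a₁ :* b₀ :* c₀) :* c1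
      :+ (:- (a₀ :* b₀ :* c₀)) :* c0
      := (c1 :* a₁ :- c0 :* a₀) :* (c0 :* b₁ :- c1 :* b₀) :* (c0 :* c₁ :- c1 :* c₀)
       :+ (c0 :* a₁ :- c1 :* a₀) :* (c1 :* b₁ :- c0 :* b₀) :* (c0 :* c₁ :- c1 :* c₀)
       :+ (c0 :* a₁ :- c1 :* a₀) :* (c0 :* b₁ :- c1 :* b₀) :* (c1 :* c₁ :- c0 :* c₀)) refl a₀ a₁ b₀ b₁ c₀ c₁

  dot-linear : ∀ π α β u w → dot π ((α · u) ⊕ (β · w)) ≡ α * dot π u + β * dot π w
  dot-linear (p₀ ∷ p₁ ∷ p₂ ∷ p₃ ∷ []) α β (u₀ ∷ u₁ ∷ u₂ ∷ u₃ ∷ []) (w₀ ∷ w₁ ∷ w₂ ∷ w₃ ∷ []) =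
    solve 14 (λ p₀ p₁ p₂ p₃ α β u₀ u₁ u₂ u₃ w₀ w₁ w₂ w₃ →
      p₀ :* (α :* u₀ :+ β :* w₀) :+ p₁ :* (α :* u₁ :+ β :* w₁) :+ p₂ :* (α :* u₂ :+ β :* w₂) :+ p₃ :* (α :* u₃ :+ β :* w₃)
      := α :* (p₀ :* u₀ :+ p₁ :* u₁ :+ p₂ :* u₂ :+ p₃ :* u₃) :+ β :* (p₀ :* w₀ :+ p₁ :* w₁ :+ p₂ :* w₂ :+ p₃ :* w₃))
      refl p₀ p₁ p₂ p₃ α β u₀ u₁ u₂ u₃ w₀ w₁ w₂ w₃

  dot-scaleʳ : ∀ π k x → dot π (k · x) ≡ k * dot π x
  dot-scaleʳ (p₀ ∷ p₁ ∷ p₂ ∷ p₃ ∷ []) k (u₀ ∷ u₁ ∷ u₂ ∷ u₃ ∷ []) = solve 9 (λ p₀ p₁ p₂ p₃ k u₀ u₁ u₂ u₃ →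
    p₀ :* (k :* u₀) :+ p₁ :* (k :* u₁) :+ p₂ :* (k :* u₂) :+ p₃ :* (k :* u₃) := k :* (p₀ :* u₀ :+ p₁ :* u₁ :+ p₂ :* u₂ :+ p₃ :* u₃))
    refl p₀ p₁ p₂ p₃ k u₀ u₁ u₂ u₃

  dot-scaleˡ : ∀ π k x → dot (k · π) x ≡ k * dot π x
  dot-scaleˡ (p₀ ∷ p₁ ∷ p₂ ∷ p₃ ∷ []) k (u₀ ∷ u₁ ∷ u₂ ∷ u₃ ∷ []) = solve 9 (λ p₀ p₁ p₂ p₃ k u₀ u₁ u₂ u₃ →
    (k :* p₀) :* u₀ :+ (k :* p₁) :* u₁ :+ (k :* p₂) :* u₂ :+ (k :* p₃) :* u₃ := k :* (p₀ :* u₀ :+ p₁ :* u₁ :+ p₂ :* u₂ :+ p₃ :* u₃))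
    refl p₀ p₁ p₂ p₃ k u₀ u₁ u₂ u₃

  dot-zeroˡ : ∀ x → dot 0v x ≡ 0#
  dot-zeroˡ (u₀ ∷ u₁ ∷ u₂ ∷ u₃ ∷ []) = solve 4 (λ u₀ u₁ u₂ u₃ → c0 :* u₀ :+ c0 :* u₁ :+ c0 :* u₂ :+ c0 :* u₃ := c0) refl u₀ u₁ u₂ u₃

  dot-zeroʳ : ∀ π → dot π 0v ≡ 0#
  dot-zeroʳ (u₀ ∷ u₁ ∷ u₂ ∷ u₃ ∷ []) = solve 4 (λ u₀ u₁ u₂ u₃ → u₀ :* c0 :+ u₁ :* c0 :+ u₂ :* c0 :+ u₃ :* c0 := c0) refl u₀ u₁ u₂ u₃

  ·-assoc : ∀ a b v → a · (b · v) ≡ (a * b) · v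
  ·-assoc a b (v₀ ∷ v₁ ∷ v₂ ∷ v₃ ∷ []) = vec≡ (sym (*-assoc _ _ _)) (sym (*-assoc _ _ _)) (sym (*-assoc _ _ _)) (sym (*-assoc _ _ _))

  ·-identityˡ : ∀ v → 1# · v ≡ v
  ·-identityˡ (v₀ ∷ v₁ ∷ v₂ ∷ v₃ ∷ []) = vec≡ (*-identityˡ v₀) (*-identityˡ v₁) (*-identityˡ v₂) (*-identityˡ v₃)

  ·-zeroˡ : ∀ v → 0# · v ≡ 0v
  ·-zeroˡ (v₀ ∷ v₁ ∷ v₂ ∷ v₃ ∷ []) = vec≡ (zeroˡ v₀) (zeroˡ v₁) (zeroˡ v₂) (zeroˡ v₃)

  ⊕-identityˡ : ∀ v → 0v ⊕ v ≡ v
  ⊕-identityˡ (v₀ ∷ v₁ ∷ v₂ ∷ v₃ ∷ []) = vec≡ (+-identityˡ v₀) (+-identityˡ v₁) (+-identityˡ v₂) (+-identityˡ v₃)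

  ⊕-identityʳ : ∀ v → v ⊕ 0v ≡ v
  ⊕-identityʳ (v₀ ∷ v₁ ∷ v₂ ∷ v₃ ∷ []) = vec≡ (+-identityʳ v₀) (+-identityʳ v₁) (+-identityʳ v₂) (+-identityʳ v₃)

  ·-distrib-⊕ : ∀ k u w → k · (u ⊕ w) ≡ (k · u) ⊕ (k · w)
  ·-distrib-⊕ k (u₀ ∷ u₁ ∷ u₂ ∷ u₃ ∷ []) (w₀ ∷ w₁ ∷ w₂ ∷ w₃ ∷ []) =
    vec≡ (distribˡ k u₀ w₀) (distribˡ k u₁ w₁) (distribˡ k u₂ w₂) (distribˡ k u₃ w₃)

  ν-scale : ∀ k v → ν (k ·₂ v) ≡ cube k · ν v
  ν-scale k (v₀ , v₁) = vec≡
    (solve 3 (λ k v₀ v₁ → (k :* v₀) :* (k :* v₀) :* (k :* v₀) := (k :* k :* k) :* (v₀ :* v₀ :* v₀)) refl k v₀ v₁)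
    (solve 3 (λ k v₀ v₁ → (k :* v₀) :* (k :* v₀) :* (k :* v₁) := (k :* k :* k) :* (v₀ :* v₀ :* v₁)) refl k v₀ v₁)
    (solve 3 (λ k v₀ v₁ → (k :* v₀) :* (k :* v₁) :* (k :* v₁) := (k :* k :* k) :* (v₀ :* v₁ :* v₁)) refl k v₀ v₁)
    (solve 3 (λ k v₀ v₁ → (k :* v₁) :* (k :* v₁) :* (k :* v₁) := (k :* k :* k) :* (v₁ :* v₁ :* v₁)) refl k v₀ v₁)

  dot-ν-expand : ∀ π x y σ τ → dot π (ν ((x ·₂ σ) +₂ (y ·₂ τ))) ≡
    x * x * x * dot π (ν σ) + x * x * y * dot π (ν-polar σ τ) + x * y * y * dot π (ν-polar τ σ) + y * y * y * dot π (ν τ)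
  dot-ν-expand (p₀ ∷ p₁ ∷ p₂ ∷ p₃ ∷ []) x y (s₀ , s₁) (t₀ , t₁) = solve 10 (λ p₀ p₁ p₂ p₃ x y s₀ s₁ t₀ t₁ →
      p₀ :* ((x :* s₀ :+ y :* t₀) :* (x :* s₀ :+ y :* t₀) :* (x :* s₀ :+ y :* t₀))
    :+ p₁ :* ((x :* s₀ :+ y :* t₀) :* (x :* s₀ :+ y :* t₀) :* (x :* s₁ :+ y :* t₁))
    :+ p₂ :* ((x :* s₀ :+ y :* t₀) :* (x :* s₁ :+ y :* t₁) :* (x :* s₁ :+ y :* t₁))
    :+ p₃ :* ((x :* s₁ :+ y :* t₁) :* (x :* s₁ :+ y :* t₁) :* (x :* s₁ :+ y :* t₁))
    := x :* x :* x :* (p₀ :* (s₀ :* s₀ :* s₀) :+ p₁ :* (s₀ :* s₀ :* s₁) :+ p₂ :* (s₀ :* s₁ :* s₁) :+ p₃ :* (s₁ :* s₁ :* s₁))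
     :+ x :* x :* y :* (p₀ :* (c3 :* (s₀ :* s₀ :* t₀)) :+ p₁ :* (s₀ :* s₀ :* t₁ :+ c2 :* (s₀ :* s₁ :* t₀)) :+ p₂ :* (c2 :* (s₀ :* s₁ :* t₁) :+ s₁ :* s₁ :* t₀) :+ p₃ :* (c3 :* (s₁ :* s₁ :* t₁)))
     :+ x :* y :* y :* (p₀ :* (c3 :* (t₀ :* t₀ :* s₀)) :+ p₁ :* (t₀ :* t₀ :* s₁ :+ c2 :* (t₀ :* t₁ :* s₀)) :+ p₂ :* (c2 :* (t₀ :* t₁ :* s₁) :+ t₁ :* t₁ :* s₀) :+ p₃ :* (c3 :* (t₁ :* t₁ :* s₁)))
     :+ y :* y :* y :* (p₀ :* (t₀ :* t₀ :* t₀) :+ p₁ :* (t₀ :* t₀ :* t₁) :+ p₂ :* (t₀ :* t₁ :* t₁) :+ p₃ :* (t₁ :* t₁ :* t₁)))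
    refl p₀ p₁ p₂ p₃ x y s₀ s₁ t₀ t₁

  planeThrough-scale₃ : ∀ a b k c → planeThrough a b (k ·₂ c) ≡ k · planeThrough a b c
  planeThrough-scale₃ (a₀ , a₁) (b₀ , b₁) k (c₀ , c₁) = vec≡
    (solve 7 (λ a₀ a₁ b₀ b₁ k c₀ c₁ → a₁ :* b₁ :* (k :* c₁) := k :* (a₁ :* b₁ :* c₁)) refl a₀ a₁ b₀ b₁ k c₀ c₁)
    (solve 7 (λ a₀ a₁ b₀ b₁ k c₀ c₁ → :- (a₀ :* b₁ :* (k :* c₁) :+ a₁ :* b₀ :* (k :* c₁) :+ a₁ :* b₁ :* (k :* c₀))
                                      := k :* (:- (a₀ :* b₁ :* c₁ :+ a₁ :* b₀ :* c₁ :+ a₁ :* b₁ :* c₀))) refl a₀ a₁ b₀ b₁ k c₀ c₁)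
    (solve 7 (λ a₀ a₁ b₀ b₁ k c₀ c₁ → a₀ :* b₀ :* (k :* c₁) :+ a₀ :* b₁ :* (k :* c₀) :+ a₁ :* b₀ :* (k :* c₀)
                                      := k :* (a₀ :* b₀ :* c₁ :+ a₀ :* b₁ :* c₀ :+ a₁ :* b₀ :* c₀)) refl a₀ a₁ b₀ b₁ k c₀ c₁)
    (solve 7 (λ a₀ a₁ b₀ b₁ k c₀ c₁ → :- (a₀ :* b₀ :* (k :* c₀)) := k :* (:- (a₀ :* b₀ :* c₀))) refl a₀ a₁ b₀ b₁ k c₀ c₁)

  det₂-self : ∀ x → det₂ x x ≡ 0#
  det₂-self (x₀ , x₁) = solve 2 (λ x₀ x₁ → x₀ :* x₁ :- x₁ :* x₀ := c0) refl x₀ x₁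

  det₂-scaleˡ : ∀ k x y → det₂ (k ·₂ x) y ≡ k * det₂ x y
  det₂-scaleˡ k (x₀ , x₁) (y₀ , y₁) = solve 5 (λ k x₀ x₁ y₀ y₁ → (k :* x₀) :* y₁ :- (k :* x₁) :* y₀ := k :* (x₀ :* y₁ :- x₁ :* y₀)) refl k x₀ x₁ y₀ y₁

  det₂-scaleʳ : ∀ k x y → det₂ x (k ·₂ y) ≡ k * det₂ x y
  det₂-scaleʳ k (x₀ , x₁) (y₀ , y₁) = solve 5 (λ k x₀ x₁ y₀ y₁ → x₀ :* (k :* y₁) :- x₁ :* (k :* y₀) := k :* (x₀ :* y₁ :- x₁ :* y₀)) refl k x₀ x₁ y₀ y₁

  det₂-antisym : ∀ x y → det₂ x y ≡ - det₂ y x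
  det₂-antisym (x₀ , x₁) (y₀ , y₁) = solve 4 (λ x₀ x₁ y₀ y₁ → x₀ :* y₁ :- x₁ :* y₀ := :- (y₀ :* x₁ :- y₁ :* x₀)) refl x₀ x₁ y₀ y₁

  det₂≡0-sym : ∀ {x y} → det₂ x y ≡ 0# → det₂ y x ≡ 0#
  det₂≡0-sym {x} {y} xy≡0 = trans (det₂-antisym y x) (trans (cong -_ xy≡0) -0#≈0#)

  det₂-subʳ : ∀ x a b → det₂ x (a -₂ b) ≡ det₂ x a - det₂ x b
  det₂-subʳ (x₀ , x₁) (a₀ , a₁) (b₀ , b₁) = solve 6 (λ x₀ x₁ a₀ a₁ b₀ b₁ →
    x₀ :* (a₁ :- b₁) :- x₁ :* (a₀ :- b₀) := (x₀ :* a₁ :- x₁ :* a₀) :- (x₀ :* b₁ :- x₁ :* b₀)) refl x₀ x₁ a₀ a₁ b₀ b₁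

  det₂-subˡ : ∀ a b c → det₂ (a -₂ b) c ≡ det₂ a c - det₂ b c
  det₂-subˡ (a₀ , a₁) (b₀ , b₁) (c₀ , c₁) = solve 6 (λ a₀ a₁ b₀ b₁ c₀ c₁ →
    (a₀ :- b₀) :* c₁ :- (a₁ :- b₁) :* c₀ := (a₀ :* c₁ :- a₁ :* c₀) :- (b₀ :* c₁ :- b₁ :* c₀)) refl a₀ a₁ b₀ b₁ c₀ c₁

  cramer : ∀ μ σ τ → det₂ σ τ ·₂ μ ≡ (det₂ μ τ ·₂ σ) -₂ (det₂ μ σ ·₂ τ)
  cramer (μ₀ , μ₁) (σ₀ , σ₁) (τ₀ , τ₁) = cong₂ _,_
    (solve 6 (λ μ₀ μ₁ σ₀ σ₁ τ₀ τ₁ → (σ₀ :* τ₁ :- σ₁ :* τ₀) :* μ₀ := (μ₀ :* τ₁ :- μ₁ :* τ₀) :* σ₀ :- (μ₀ :* σ₁ :- μ₁ :* σ₀) :* τ₀) refl μ₀ μ₁ σ₀ σ₁ τ₀ τ₁)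
    (solve 6 (λ μ₀ μ₁ σ₀ σ₁ τ₀ τ₁ → (σ₀ :* τ₁ :- σ₁ :* τ₀) :* μ₁ := (μ₀ :* τ₁ :- μ₁ :* τ₀) :* σ₁ :- (μ₀ :* σ₁ :- μ₁ :* σ₀) :* τ₁) refl μ₀ μ₁ σ₀ σ₁ τ₀ τ₁)

  det₂-zero-pair : ∀ x y → x ≡ (0# , 0#) → det₂ x y ≡ 0#
  det₂-zero-pair _ (y₀ , y₁) refl = solve 2 (λ y₀ y₁ → c0 :* y₁ :- c0 :* y₀ := c0) refl y₀ y₁

  det₂≡0∧det₂≡0⇒zero : ∀ μ σ τ → ¬ det₂ σ τ ≡ 0# → det₂ μ σ ≡ 0# → det₂ μ τ ≡ 0# → ¬ NonzeroPair μ
  det₂≡0∧det₂≡0⇒zero μ σ τ στ≢0 μσ≡0 μτ≡0 μ≢0 = μ≢0 (component-≡0 (cong proj₁ cramer′) , component-≡0 (cong proj₂ cramer′))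
    where
      cramer′ : det₂ σ τ ·₂ μ ≡ (0# ·₂ σ) -₂ (0# ·₂ τ)
      cramer′ = trans (cramer μ σ τ) (cong₂ (λ a b → (a ·₂ σ) -₂ (b ·₂ τ)) μτ≡0 μσ≡0)
      component-≡0 : ∀ {m a b} → det₂ σ τ * m ≡ 0# * a - 0# * b → m ≡ 0#
      component-≡0 {m} {a} {b} e = x*y≡0∧x≢0⇒y≡0 (trans e (solve 2 (λ a b → c0 :* a :- c0 :* b := c0) refl a b)) στ≢0

  det₂-homog≡0⇒≡ : ∀ u v → det₂ (homog u) (homog v) ≡ 0# → u ≡ v
  det₂-homog≡0⇒≡ (just a) (just b) e = cong just (sym (x-y≡0⇒x≡y _ _ (trans (solve 2 (λ a b → b :- a := c1 :* b :- a :* c1) refl a b) e)))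
  det₂-homog≡0⇒≡ (just a) nothing e = ⊥-elim (1≢0 (trans (solve 1 (λ a → c1 := c1 :* c1 :- a :* c0) refl a) e))
  det₂-homog≡0⇒≡ nothing (just b) e = ⊥-elim (1≢0 (trans (solve 1 (λ b → c1 := :- (c0 :* b :- c1 :* c1)) refl b) (trans (cong -_ e) -0#≈0#)))
  det₂-homog≡0⇒≡ nothing nothing e = refl

  det₂-homog-≢0 : ∀ {u v} → ¬ u ≡ v → ¬ det₂ (homog u) (homog v) ≡ 0#
  det₂-homog-≢0 {u} {v} u≢v e = u≢v (det₂-homog≡0⇒≡ u v e)

  homog-nonzero : ∀ u → NonzeroPair (homog u)
  homog-nonzero (just t) (1≡0 , _) = 1≢0 1≡0
  homog-nonzero nothing (_ , 1≡0) = 1≢0 1≡0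

  det₂-homog′-homog-≢0 : ∀ u → ¬ det₂ (homog′ u) (homog u) ≡ 0#
  det₂-homog′-homog-≢0 (just t) e = 1≢0 (trans (solve 1 (λ t → c1 := :- (c0 :* t :- c1 :* c1)) refl t) (trans (cong -_ e) -0#≈0#))
  det₂-homog′-homog-≢0 nothing e = 1≢0 (trans (solve 0 (c1 := c1 :* c1 :- c0 :* c0) refl) e)

  module _ (u : Param) (a b c : F²) where

    private
      h = homog u
      h′ = homog′ u

    T-on-planeThrough : det₂ h a ≡ 0# → det₂ h c ≡ 0# → dot (planeThrough a b c) (T u) ≡ 0#
    T-on-planeThrough ha≡0 hc≡0 = trans (dot-planeThrough-T u a b c)
      (trans (cong₂ (λ z w → det₂ h′ a * det₂ h b * w + z * det₂ h′ b * w + z * det₂ h b * det₂ h′ c) ha≡0 hc≡0)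
        (solve 4 (λ p q m n → p :* q :* c0 :+ c0 :* m :* c0 :+ c0 :* q :* n := c0) refl _ _ _ _))

    T-off-planeThrough₁ : det₂ h a ≡ 0# → ¬ det₂ h b ≡ 0# → ¬ det₂ h c ≡ 0# → ¬ det₂ h′ a ≡ 0# →
                          ¬ dot (planeThrough a b c) (T u) ≡ 0#
    T-off-planeThrough₁ ha≡0 hb≢0 hc≢0 h′a≢0 dot≡0 = *-≢0 (*-≢0 h′a≢0 hb≢0) hc≢0 (begin
        det₂ h′ a * det₂ h b * det₂ h c
          ≡⟨ solve 5 (λ p q r m n → p :* q :* r := p :* q :* r :+ c0 :* m :* r :+ c0 :* q :* n) refl _ _ _ (det₂ h′ b) (det₂ h′ c) ⟩
        det₂ h′ a * det₂ h b * det₂ h c + 0# * det₂ h′ b * det₂ h c + 0# * det₂ h b * det₂ h′ c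
          ≡⟨ cong (λ z → det₂ h′ a * det₂ h b * det₂ h c + z * det₂ h′ b * det₂ h c + z * det₂ h b * det₂ h′ c) (sym ha≡0) ⟩
        det₂ h′ a * det₂ h b * det₂ h c + det₂ h a * det₂ h′ b * det₂ h c + det₂ h a * det₂ h b * det₂ h′ c
          ≡⟨ sym (dot-planeThrough-T u a b c) ⟩
        dot (planeThrough a b c) (T u)
          ≡⟨ dot≡0 ⟩
        0# ∎)
      where open ≡-Reasoning

    T-off-planeThrough₂ : det₂ h b ≡ 0# → ¬ det₂ h a ≡ 0# → ¬ det₂ h c ≡ 0# → ¬ det₂ h′ b ≡ 0# →
                          ¬ dot (planeThrough a b c) (T u) ≡ 0#
    T-off-planeThrough₂ hb≡0 ha≢0 hc≢0 h′b≢0 dot≡0 = *-≢0 (*-≢0 ha≢0 h′b≢0) hc≢0 (begin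
        det₂ h a * det₂ h′ b * det₂ h c
          ≡⟨ solve 5 (λ p q r m n → p :* q :* r := m :* c0 :* r :+ p :* q :* r :+ p :* c0 :* n) refl _ _ _ (det₂ h′ a) (det₂ h′ c) ⟩
        det₂ h′ a * 0# * det₂ h c + det₂ h a * det₂ h′ b * det₂ h c + det₂ h a * 0# * det₂ h′ c
          ≡⟨ cong (λ z → det₂ h′ a * z * det₂ h c + det₂ h a * det₂ h′ b * det₂ h c + det₂ h a * z * det₂ h′ c) (sym hb≡0) ⟩
        det₂ h′ a * det₂ h b * det₂ h c + det₂ h a * det₂ h′ b * det₂ h c + det₂ h a * det₂ h b * det₂ h′ c
          ≡⟨ sym (dot-planeThrough-T u a b c) ⟩
        dot (planeThrough a b c) (T u)
          ≡⟨ dot≡0 ⟩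
        0# ∎)
      where open ≡-Reasoning

  dot-Π-P : ∀ u v → dot (Π u) (P v) ≡ Π-sign u * cube (det₂ (homog u) (homog v))
  dot-Π-P u v = trans (cong (dot (Π u)) (P≡ν∘homog v)) (dot-Π-ν u (homog v))

  Π-P≡0⇒≡ : ∀ u v → dot (Π u) (P v) ≡ 0# → u ≡ v
  Π-P≡0⇒≡ u v dot≡0 = det₂-homog≡0⇒≡ u v (cube≡0⇒x≡0 (x*y≡0∧x≢0⇒y≡0 (trans (sym (dot-Π-P u v)) dot≡0) (Π-sign-≢0 u)))

  Π-P-self : ∀ u → dot (Π u) (P u) ≡ 0#
  Π-P-self u = trans (dot-Π-P u u) (trans (cong (λ z → Π-sign u * cube z) (det₂-self (homog u))) (trans (cong (Π-sign u *_) cube-0) (zeroʳ _)))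

  dot-planeThrough-P : ∀ a b c v → dot (planeThrough a b c) (P v) ≡ det₂ (homog v) a * det₂ (homog v) b * det₂ (homog v) c
  dot-planeThrough-P a b c v = trans (cong (dot (planeThrough a b c)) (P≡ν∘homog v)) (dot-planeThrough-ν a b c (homog v))

  ~-refl : ∀ {x} → x ~ x
  ~-refl {x} = 1# , 1≢0 , sym (·-identityˡ x)

  ~-sym : ∀ {x y} → x ~ y → y ~ x
  ~-sym {x} {y} (k , k≢0 , x≡ky) = k ⁻¹ , ⁻¹-≢0 k≢0 , sym (begin
      (k ⁻¹) · x        ≡⟨ cong ((k ⁻¹) ·_) x≡ky ⟩
      (k ⁻¹) · (k · y)  ≡⟨ ·-assoc _ _ y ⟩
      (k ⁻¹ * k) · y    ≡⟨ cong (_· y) (⁻¹-inverseˡ k≢0) ⟩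
      1# · y            ≡⟨ ·-identityˡ y ⟩
      y                 ∎)
    where open ≡-Reasoning

  ~-trans : ∀ {x y z} → x ~ y → y ~ z → x ~ z
  ~-trans {z = z} (k , k≢0 , x≡ky) (l , l≢0 , y≡lz) = k * l , *-≢0 k≢0 l≢0 , trans x≡ky (trans (cong (k ·_) y≡lz) (·-assoc k l z))

  OnPlane-respʳ-~ : ∀ π {x y} → x ~ y → OnPlane π x → OnPlane π y
  OnPlane-respʳ-~ π {y = y} (k , k≢0 , x≡ky) πx≡0 =
    x*y≡0∧x≢0⇒y≡0 (trans (sym (dot-scaleʳ π k y)) (trans (cong (dot π) (sym x≡ky)) πx≡0)) k≢0

  OnPlane-respˡ-~ : ∀ {π π'} x → π ~ π' → OnPlane π x → OnPlane π' x
  OnPlane-respˡ-~ {π' = π'} x (k , k≢0 , π≡kπ') πx≡0 =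
    x*y≡0∧x≢0⇒y≡0 (trans (sym (dot-scaleˡ π' k x)) (trans (cong (λ z → dot z x) (sym π≡kπ')) πx≡0)) k≢0

  toParam : F² → Param
  toParam (x₀ , x₁) with x₀ ≟ 0#
  ... | yes _ = nothing
  ... | no _ = just (x₁ * x₀ ⁻¹)

  toParam-spec : ∀ x → NonzeroPair x → Σ Carrier λ k → ¬ k ≡ 0# × x ≡ k ·₂ homog (toParam x)
  toParam-spec (x₀ , x₁) x≢0 with x₀ ≟ 0#
  ... | yes x₀≡0 = x₁ , (λ x₁≡0 → x≢0 (x₀≡0 , x₁≡0)) , cong₂ _,_ (trans x₀≡0 (sym (zeroʳ x₁))) (sym (*-identityʳ x₁))
  ... | no x₀≢0 = x₀ , x₀≢0 , cong₂ _,_ (sym (*-identityʳ x₀)) (sym (begin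
        x₀ * (x₁ * x₀ ⁻¹)    ≡⟨ *-comm x₀ _ ⟩
        x₁ * x₀ ⁻¹ * x₀      ≡⟨ *-assoc _ _ _ ⟩
        x₁ * (x₀ ⁻¹ * x₀)    ≡⟨ cong (x₁ *_) (⁻¹-inverseˡ x₀≢0) ⟩
        x₁ * 1#              ≡⟨ *-identityʳ x₁ ⟩
        x₁                   ∎))
    where open ≡-Reasoning

  toParam-scale : ∀ k u → ¬ k ≡ 0# → toParam (k ·₂ homog u) ≡ u
  toParam-scale k (just t) k≢0 with (k * 1#) ≟ 0#
  ... | yes k≡0 = ⊥-elim (k≢0 (trans (sym (*-identityʳ k)) k≡0))
  ... | no _ = cong just (begin
        k * t * (k * 1#) ⁻¹   ≡⟨ cong (λ z → k * t * z ⁻¹) (*-identityʳ k) ⟩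
        k * t * k ⁻¹          ≡⟨ *-comm _ _ ⟩
        k ⁻¹ * (k * t)        ≡⟨ sym (*-assoc _ _ _) ⟩
        k ⁻¹ * k * t          ≡⟨ cong (_* t) (⁻¹-inverseˡ k≢0) ⟩
        1# * t                ≡⟨ *-identityˡ t ⟩
        t                     ∎)
    where open ≡-Reasoning
  toParam-scale k nothing k≢0 with (k * 0#) ≟ 0#
  ... | yes _ = refl
  ... | no k*0≢0 = ⊥-elim (k*0≢0 (zeroʳ k))

  -- Evaluating at ν (1,0), ν (0,1), ν (1,1) and ν (1,a) recovers all four coordinates of a plane once a ∉ {0, 1}.
  module _ (a : Carrier) (a≢0 : ¬ a ≡ 0#) (a≢1 : ¬ a ≡ 1#) where

    ν-dot-injective : ∀ π π' → (∀ v → dot π (ν v) ≡ dot π' (ν v)) → π ≡ π'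
    ν-dot-injective (p₀ ∷ p₁ ∷ p₂ ∷ p₃ ∷ []) (q₀ ∷ q₁ ∷ q₂ ∷ q₃ ∷ []) agree = vec≡ p₀≡q₀ p₁≡q₁ p₂≡q₂ p₃≡q₃
      where
        at10 : ∀ p₀ p₁ p₂ p₃ → dot (p₀ ∷ p₁ ∷ p₂ ∷ p₃ ∷ []) (ν (1# , 0#)) ≡ p₀
        at10 = solve 4 (λ p₀ p₁ p₂ p₃ → p₀ :* (c1 :* c1 :* c1) :+ p₁ :* (c1 :* c1 :* c0) :+ p₂ :* (c1 :* c0 :* c0) :+ p₃ :* (c0 :* c0 :* c0) := p₀) refl
        at01 : ∀ p₀ p₁ p₂ p₃ → dot (p₀ ∷ p₁ ∷ p₂ ∷ p₃ ∷ []) (ν (0# , 1#)) ≡ p₃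
        at01 = solve 4 (λ p₀ p₁ p₂ p₃ → p₀ :* (c0 :* c0 :* c0) :+ p₁ :* (c0 :* c0 :* c1) :+ p₂ :* (c0 :* c1 :* c1) :+ p₃ :* (c1 :* c1 :* c1) := p₃) refl
        at11 : ∀ p₀ p₁ p₂ p₃ → dot (p₀ ∷ p₁ ∷ p₂ ∷ p₃ ∷ []) (ν (1# , 1#)) ≡ p₀ + (p₁ + p₂) + p₃
        at11 = solve 4 (λ p₀ p₁ p₂ p₃ → p₀ :* (c1 :* c1 :* c1) :+ p₁ :* (c1 :* c1 :* c1) :+ p₂ :* (c1 :* c1 :* c1) :+ p₃ :* (c1 :* c1 :* c1) := p₀ :+ (p₁ :+ p₂) :+ p₃) refl
        at1a : ∀ p₀ p₁ p₂ p₃ → dot (p₀ ∷ p₁ ∷ p₂ ∷ p₃ ∷ []) (ν (1# , a)) ≡ p₀ + (p₁ * a + p₂ * (a * a)) + p₃ * cube a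
        at1a p₀ p₁ p₂ p₃ = solve 5 (λ p₀ p₁ p₂ p₃ a → p₀ :* (c1 :* c1 :* c1) :+ p₁ :* (c1 :* c1 :* a) :+ p₂ :* (c1 :* a :* a) :+ p₃ :* (a :* a :* a)
                                   := p₀ :+ (p₁ :* a :+ p₂ :* (a :* a)) :+ p₃ :* (a :* a :* a)) refl p₀ p₁ p₂ p₃ a
        cancel-outer : ∀ {x y z y'} → x + y + z ≡ x + y' + z → y ≡ y'
        cancel-outer {x} {y} {z} {y'} e = x-y≡0⇒x≡y _ _ (trans (solve 4 (λ x y z y' → y :- y' := (x :+ y :+ z) :- (x :+ y' :+ z)) refl x y z y') (x≡y⇒x-y≡0 e))
        p₀≡q₀ : p₀ ≡ q₀
        p₀≡q₀ = trans (sym (at10 p₀ p₁ p₂ p₃)) (trans (agree (1# , 0#)) (at10 q₀ q₁ q₂ q₃))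
        p₃≡q₃ : p₃ ≡ q₃
        p₃≡q₃ = trans (sym (at01 p₀ p₁ p₂ p₃)) (trans (agree (0# , 1#)) (at01 q₀ q₁ q₂ q₃))
        p₁+p₂≡q₁+q₂ : p₁ + p₂ ≡ q₁ + q₂
        p₁+p₂≡q₁+q₂ = cancel-outer (trans (sym (at11 p₀ p₁ p₂ p₃)) (trans (agree (1# , 1#)) (trans (at11 q₀ q₁ q₂ q₃)
                        (cong₂ (λ u w → u + (q₁ + q₂) + w) (sym p₀≡q₀) (sym p₃≡q₃)))))
        p₁a+p₂a²≡ : p₁ * a + p₂ * (a * a) ≡ q₁ * a + q₂ * (a * a)
        p₁a+p₂a²≡ = cancel-outer (trans (sym (at1a p₀ p₁ p₂ p₃)) (trans (agree (1# , a)) (trans (at1a q₀ q₁ q₂ q₃)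
                      (cong₂ (λ u w → u + (q₁ * a + q₂ * (a * a)) + w * cube a) (sym p₀≡q₀) (sym p₃≡q₃)))))
        [a²-a][p₂-q₂]≡0 : (a * a - a) * (p₂ - q₂) ≡ 0#
        [a²-a][p₂-q₂]≡0 = begin
          (a * a - a) * (p₂ - q₂)
            ≡⟨ solve 5 (λ p₁ p₂ q₁ q₂ a → (a :* a :- a) :* (p₂ :- q₂) := (p₁ :* a :+ p₂ :* (a :* a) :- (q₁ :* a :+ q₂ :* (a :* a))) :- a :* ((p₁ :+ p₂) :- (q₁ :+ q₂))) refl p₁ p₂ q₁ q₂ a ⟩
          (p₁ * a + p₂ * (a * a) - (q₁ * a + q₂ * (a * a))) - a * ((p₁ + p₂) - (q₁ + q₂))
            ≡⟨ cong₂ (λ u v → u - a * v) (x≡y⇒x-y≡0 p₁a+p₂a²≡) (x≡y⇒x-y≡0 p₁+p₂≡q₁+q₂) ⟩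
          0# - a * 0#
            ≡⟨ solve 1 (λ a → c0 :- a :* c0 := c0) refl a ⟩
          0# ∎
          where open ≡-Reasoning
        a²-a≢0 : ¬ a * a - a ≡ 0#
        a²-a≢0 a²-a≡0 = a≢1 (x-y≡0⇒x≡y _ _ (x*y≡0∧x≢0⇒y≡0 (trans (solve 1 (λ a → a :* (a :- c1) := a :* a :- a) refl a) a²-a≡0) a≢0))
        p₂≡q₂ : p₂ ≡ q₂
        p₂≡q₂ = x-y≡0⇒x≡y _ _ (x*y≡0∧x≢0⇒y≡0 [a²-a][p₂-q₂]≡0 a²-a≢0)
        p₁≡q₁ : p₁ ≡ q₁
        p₁≡q₁ = trans (sym (trans (+-assoc p₁ p₂ (- p₂)) (trans (cong (p₁ +_) (-‿inverseʳ p₂)) (+-identityʳ p₁))))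
                  (trans (cong₂ _-_ p₁+p₂≡q₁+q₂ p₂≡q₂) (trans (+-assoc q₁ q₂ (- q₂)) (trans (cong (q₁ +_) (-‿inverseʳ q₂)) (+-identityʳ q₁))))

  _≟ₚ_ : DecidableEquality Param
  _≟ₚ_ = Maybeₚ.≡-dec _≟_

  module Params = DecidableLists _≟ₚ_

  params : List Param
  params = nothing ∷ map just elements

  params-complete : ∀ u → u ∈ params
  params-complete nothing = here refl
  params-complete (just x) = there (∈-map⁺ just (elements-complete x))

  params-unique : Unique params
  params-unique = Allₚ.¬Any⇒All¬ _ nothing∉ ∷ Uniqueₚ.map⁺ Maybeₚ.just-injective elements-unique
    where
      nothing∉ : ¬ nothing ∈ map just elements
      nothing∉ nothing∈ with ∈-map⁻ just nothing∈
      ... | _ , _ , ()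

  length-params : length params ≡ suc card
  length-params = cong suc (length-map just elements)

  MeetCount-resp-~ : ∀ {π π' n} → π ~ π' → MeetCount π n → MeetCount π' n
  MeetCount-resp-~ π~π' = countMod-⇔ (OnPlane-respˡ-~ _ π~π') (OnPlane-respˡ-~ _ (~-sym π~π'))

  OscCount-resp-~ : ∀ {x y n} → x ~ y → OscCount x n → OscCount y n
  OscCount-resp-~ x~y = countMod-⇔ (λ {u} → OnPlane-respʳ-~ (Π u) x~y) (λ {u} → OnPlane-respʳ-~ (Π u) (~-sym x~y))

module PlanesThroughChord (𝔽 : FiniteField) (s t : Geometry.Param 𝔽) (s≢t : ¬ s ≡ t) where

  open BinaryForms 𝔽

  σ τ : F²
  σ = homog s
  τ = homog t

  D : Carrier
  D = det₂ σ τ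

  D≢0 : ¬ D ≡ 0#
  D≢0 = det₂-homog-≢0 s≢t

  chordPlane : Param → V
  chordPlane w = planeThrough σ τ (homog w)

  dot-chordPlane-P : ∀ w v → dot (chordPlane w) (P v) ≡ det₂ (homog v) σ * det₂ (homog v) τ * det₂ (homog v) (homog w)
  dot-chordPlane-P w = dot-planeThrough-P σ τ (homog w)

  chordPlane-roots : ∀ w v → OnPlane (chordPlane w) (P v) → v ≡ s ⊎ v ≡ t ⊎ v ≡ w
  chordPlane-roots w v on = roots (x*y*z≡0⇒ (trans (sym (dot-chordPlane-P w v)) on))
    where
      roots : det₂ (homog v) σ ≡ 0# ⊎ det₂ (homog v) τ ≡ 0# ⊎ det₂ (homog v) (homog w) ≡ 0# → v ≡ s ⊎ v ≡ t ⊎ v ≡ w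
      roots (inj₁ vs≡0) = inj₁ (det₂-homog≡0⇒≡ v s vs≡0)
      roots (inj₂ (inj₁ vt≡0)) = inj₂ (inj₁ (det₂-homog≡0⇒≡ v t vt≡0))
      roots (inj₂ (inj₂ vw≡0)) = inj₂ (inj₂ (det₂-homog≡0⇒≡ v w vw≡0))

  chordPlane-∋s : ∀ w → OnPlane (chordPlane w) (P s)
  chordPlane-∋s w = trans (dot-chordPlane-P w s) (trans (cong (λ z → z * D * det₂ σ (homog w)) (det₂-self σ))
                      (trans (cong (_* det₂ σ (homog w)) (zeroˡ D)) (zeroˡ _)))

  chordPlane-∋t : ∀ w → OnPlane (chordPlane w) (P t)
  chordPlane-∋t w = trans (dot-chordPlane-P w t) (trans (cong (λ z → det₂ τ σ * z * det₂ τ (homog w)) (det₂-self τ))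
                      (trans (cong (_* det₂ τ (homog w)) (zeroʳ _)) (zeroˡ _)))

  chordPlane-∋w : ∀ w → OnPlane (chordPlane w) (P w)
  chordPlane-∋w w = trans (dot-chordPlane-P w w) (trans (cong (det₂ (homog w) σ * det₂ (homog w) τ *_) (det₂-self (homog w))) (zeroʳ _))

  -- The plane misses the tangent vector T at one of the points s and t.
  chordPlane-nonzero : ∀ w → Nonzero (chordPlane w)
  chordPlane-nonzero w chordPlane≡0 with w ≟ₚ s
  ... | yes refl = T-off-planeThrough₂ t σ τ σ (det₂-self τ) (det₂-homog-≢0 (≢-sym s≢t)) (det₂-homog-≢0 (≢-sym s≢t)) (det₂-homog′-homog-≢0 t)
                     (trans (cong (λ z → dot z (T t)) chordPlane≡0) (dot-zeroˡ (T t)))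
  ... | no w≢s = T-off-planeThrough₁ s σ τ (homog w) (det₂-self σ) D≢0 (det₂-homog-≢0 (≢-sym w≢s)) (det₂-homog′-homog-≢0 s)
                   (trans (cong (λ z → dot z (T s)) chordPlane≡0) (dot-zeroˡ (T s)))

  ends≁ : ¬ chordPlane s ~ chordPlane t
  ends≁ (k , k≢0 , ps≡kpt) = T-off-planeThrough₁ s σ τ τ (det₂-self σ) D≢0 D≢0 (det₂-homog′-homog-≢0 s)
    (x*y≡0∧x≢0⇒y≡0 (trans (sym (dot-scaleˡ (chordPlane t) k (T s)))
      (trans (cong (λ z → dot z (T s)) (sym ps≡kpt)) (T-on-planeThrough s σ τ σ (det₂-self σ) (det₂-self σ)))) k≢0)

  chordPlane-injective : ∀ {w w'} → ¬ w ≡ s → ¬ w ≡ t → chordPlane w ~ chordPlane w' → w ≡ w'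
  chordPlane-injective {w} {w'} w≢s w≢t pw~pw' = third (chordPlane-roots w' w (OnPlane-respˡ-~ (P w) pw~pw' (chordPlane-∋w w)))
    where
      third : w ≡ s ⊎ w ≡ t ⊎ w ≡ w' → w ≡ w'
      third (inj₁ w≡s) = ⊥-elim (w≢s w≡s)
      third (inj₂ (inj₁ w≡t)) = ⊥-elim (w≢t w≡t)
      third (inj₂ (inj₂ w≡w')) = w≡w'

  not-osculating : ∀ π → OnPlane π (P s) → OnPlane π (P t) → ¬ Osculating π
  not-osculating π π∋s π∋t (u , π~Πu) =
    s≢t (trans (sym (Π-P≡0⇒≡ u s (OnPlane-respˡ-~ (P s) π~Πu π∋s))) (Π-P≡0⇒≡ u t (OnPlane-respˡ-~ (P t) π~Πu π∋t)))

  meetCount-end : ∀ w → w ≡ s ⊎ w ≡ t → MeetCount (chordPlane w) 2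
  meetCount-end w w∈st = (s ∷ t ∷ []) , refl , (chordPlane-∋s w ∷ chordPlane-∋t w ∷ []) , ((s≢t ∷ []) ∷ [] ∷ []) ,
                         λ v on → cover v (chordPlane-roots w v on) w∈st
    where
      cover : ∀ v → v ≡ s ⊎ v ≡ t ⊎ v ≡ w → w ≡ s ⊎ w ≡ t → v ∈ s ∷ t ∷ []
      cover v (inj₁ v≡s) _ = here v≡s
      cover v (inj₂ (inj₁ v≡t)) _ = there (here v≡t)
      cover v (inj₂ (inj₂ v≡w)) (inj₁ w≡s) = here (trans v≡w w≡s)
      cover v (inj₂ (inj₂ v≡w)) (inj₂ w≡t) = there (here (trans v≡w w≡t))

  meetCount-inner : ∀ w → ¬ w ≡ s → ¬ w ≡ t → MeetCount (chordPlane w) 3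
  meetCount-inner w w≢s w≢t = (s ∷ t ∷ w ∷ []) , refl , (chordPlane-∋s w ∷ chordPlane-∋t w ∷ chordPlane-∋w w ∷ []) ,
      ((s≢t ∷ ≢-sym w≢s ∷ []) ∷ (≢-sym w≢t ∷ []) ∷ [] ∷ []) , λ v on → cover v (chordPlane-roots w v on)
    where
      cover : ∀ v → v ≡ s ⊎ v ≡ t ⊎ v ≡ w → v ∈ s ∷ t ∷ w ∷ []
      cover v (inj₁ v≡s) = here v≡s
      cover v (inj₂ (inj₁ v≡t)) = there (here v≡t)
      cover v (inj₂ (inj₂ v≡w)) = there (there (here v≡w))

  meetCount-chordPlane : ∀ {π n} w → π ~ chordPlane w → MeetCount π n →
                         ((w ≡ s ⊎ w ≡ t) × n ≡ 2) ⊎ ((¬ w ≡ s × ¬ w ≡ t) × n ≡ 3)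
  meetCount-chordPlane {π} {n} w π~pw count = cases (w ≟ₚ s) (w ≟ₚ t)
    where
      count′ : MeetCount (chordPlane w) n
      count′ = MeetCount-resp-~ π~pw count
      cases : Dec (w ≡ s) → Dec (w ≡ t) → ((w ≡ s ⊎ w ≡ t) × n ≡ 2) ⊎ ((¬ w ≡ s × ¬ w ≡ t) × n ≡ 3)
      cases (yes w≡s) _ = inj₁ (inj₁ w≡s , Params.countMod≡-unique count′ (meetCount-end w (inj₁ w≡s)) (λ x → x) (λ x → x))
      cases (no _) (yes w≡t) = inj₁ (inj₂ w≡t , Params.countMod≡-unique count′ (meetCount-end w (inj₂ w≡t)) (λ x → x) (λ x → x))
      cases (no w≢s) (no w≢t) = inj₂ ((w≢s , w≢t) , Params.countMod≡-unique count′ (meetCount-inner w w≢s w≢t) (λ x → x) (λ x → x))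

  -- Expanding π · ν (x σ + y τ) with π · ν σ = π · ν τ = 0 exhibits D³ (π · ν v) as the cubic form of a chordPlane.
  module _ (π : V) (π∋s : OnPlane π (P s)) (π∋t : OnPlane π (P t)) where

    private
      k₁ k₂ : Carrier
      k₁ = dot π (ν-polar σ τ)
      k₂ = dot π (ν-polar τ σ)

    thirdRoot : F²
    thirdRoot = (k₂ ·₂ σ) -₂ (k₁ ·₂ τ)

    D³*dot-ν : ∀ v → cube D * dot π (ν v) ≡ dot (planeThrough σ τ thirdRoot) (ν v)
    D³*dot-ν v = begin
        cube D * dot π (ν v)                              ≡⟨ sym (dot-scaleʳ π (cube D) (ν v)) ⟩
        dot π (cube D · ν v)                              ≡⟨ cong (dot π) (sym (ν-scale D v)) ⟩
        dot π (ν (D ·₂ v))                                ≡⟨ cong (λ z → dot π (ν z)) (trans (cramer v σ τ) (cong₂ _,_ (minus (x * proj₁ σ) (proj₁ τ)) (minus (x * proj₂ σ) (proj₂ τ)))) ⟩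
        dot π (ν ((x ·₂ σ) +₂ ((- y) ·₂ τ)))              ≡⟨ dot-ν-expand π x (- y) σ τ ⟩
        x * x * x * dot π (ν σ) + x * x * (- y) * k₁ + x * (- y) * (- y) * k₂ + (- y) * (- y) * (- y) * dot π (ν τ)
          ≡⟨ cong₂ (λ u w → x * x * x * u + x * x * (- y) * k₁ + x * (- y) * (- y) * k₂ + (- y) * (- y) * (- y) * w)
                   (trans (cong (dot π) (sym (P≡ν∘homog s))) π∋s) (trans (cong (dot π) (sym (P≡ν∘homog t))) π∋t) ⟩
        x * x * x * 0# + x * x * (- y) * k₁ + x * (- y) * (- y) * k₂ + (- y) * (- y) * (- y) * 0#
          ≡⟨ solve 4 (λ x y k₁ k₂ → x :* x :* x :* c0 :+ x :* x :* (:- y) :* k₁ :+ x :* (:- y) :* (:- y) :* k₂ :+ (:- y) :* (:- y) :* (:- y) :* c0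
                                    := y :* x :* (k₂ :* y :- k₁ :* x)) refl x y k₁ k₂ ⟩
        y * x * (k₂ * y - k₁ * x)                         ≡⟨ cong (y * x *_) (sym (trans (det₂-subʳ v (k₂ ·₂ σ) (k₁ ·₂ τ)) (cong₂ _-_ (det₂-scaleʳ k₂ v σ) (det₂-scaleʳ k₁ v τ)))) ⟩
        y * x * det₂ v thirdRoot                          ≡⟨ sym (dot-planeThrough-ν σ τ thirdRoot v) ⟩
        dot (planeThrough σ τ thirdRoot) (ν v)            ∎
      where
        open ≡-Reasoning
        x = det₂ v τ
        y = det₂ v σ
        minus : ∀ a c → a - y * c ≡ a + (- y) * c
        minus a c = cong (a +_) (-‿distribˡ-* y c)

    module _ (a : Carrier) (a≢0 : ¬ a ≡ 0#) (a≢1 : ¬ a ≡ 1#) (π≢0 : Nonzero π) where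

      thirdRoot-nonzero : NonzeroPair thirdRoot
      thirdRoot-nonzero (r₀≡0 , r₁≡0) = π≢0 (ν-dot-injective a a≢0 a≢1 π 0v (λ v → trans (vanishes v) (sym (dot-zeroˡ (ν v)))))
        where
          v-thirdRoot≡0 : ∀ v → det₂ v thirdRoot ≡ 0#
          v-thirdRoot≡0 v = det₂≡0-sym (det₂-zero-pair thirdRoot v (cong₂ _,_ r₀≡0 r₁≡0))
          vanishes : ∀ v → dot π (ν v) ≡ 0#
          vanishes v = x*y≡0∧x≢0⇒y≡0
            (trans (D³*dot-ν v) (trans (dot-planeThrough-ν σ τ thirdRoot v) (trans (cong (det₂ v σ * det₂ v τ *_) (v-thirdRoot≡0 v)) (zeroʳ _))))
            (cube-≢0 D≢0)

      chordPlane-complete : Σ Param λ w → π ~ chordPlane w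
      chordPlane-complete = w , cube D ⁻¹ * k , *-≢0 (⁻¹-≢0 (cube-≢0 D≢0)) k≢0 ,
                            ν-dot-injective a a≢0 a≢1 π ((cube D ⁻¹ * k) · chordPlane w) agree
        where
          w = toParam thirdRoot
          spec = toParam-spec thirdRoot thirdRoot-nonzero
          k = proj₁ spec
          k≢0 = proj₁ (proj₂ spec)
          agree : ∀ v → dot π (ν v) ≡ dot ((cube D ⁻¹ * k) · chordPlane w) (ν v)
          agree v = begin
              dot π (ν v)                                 ≡⟨ x≡k*y⇒y≡k⁻¹*x (cube-≢0 D≢0) (sym D³*dot≡) ⟩
              cube D ⁻¹ * (k * dot (chordPlane w) (ν v))   ≡⟨ sym (*-assoc _ _ _) ⟩
              cube D ⁻¹ * k * dot (chordPlane w) (ν v)     ≡⟨ sym (dot-scaleˡ (chordPlane w) (cube D ⁻¹ * k) (ν v)) ⟩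
              dot ((cube D ⁻¹ * k) · chordPlane w) (ν v)   ∎
            where
              open ≡-Reasoning
              D³*dot≡ : cube D * dot π (ν v) ≡ k * dot (chordPlane w) (ν v)
              D³*dot≡ = trans (D³*dot-ν v) (trans (cong (λ z → dot (planeThrough σ τ z) (ν v)) (proj₂ (proj₂ spec)))
                          (trans (cong (λ z → dot z (ν v)) (planeThrough-scale₃ σ τ k (homog w))) (dot-scaleˡ (chordPlane w) k (ν v))))

  inner-params-count : CountMod _≡_ (λ w → ¬ w ≡ s × ¬ w ≡ t) (card ℕ.∸ 1)
  inner-params-count = subst (CountMod _≡_ (λ w → ¬ w ≡ s × ¬ w ≡ t)) (cong (ℕ._∸ 2) length-params)
                         (Params.two-excluded-count params params-unique params-complete s≢t)

  module _ (a : Carrier) (a≢0 : ¬ a ≡ 0#) (a≢1 : ¬ a ≡ 1#) where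

    private
      ThroughChord : V → Set
      ThroughChord π = Nonzero π × PlaneThroughLine (P s) (P t) π

      EndOrInner : Param → ℕ → Set
      EndOrInner w n = ((w ≡ s ⊎ w ≡ t) × n ≡ 2) ⊎ ((¬ w ≡ s × ¬ w ≡ t) × n ≡ 3)

      classify : ∀ {π n} → ThroughChord π → MeetCount π n → Σ Param λ w → π ~ chordPlane w × EndOrInner w n
      classify {π} (π≢0 , π∋s , π∋t) count =
        let (w , π~pw) = chordPlane-complete π π∋s π∋t a a≢0 a≢1 π≢0 in w , π~pw , meetCount-chordPlane w π~pw count

      not-2-or-3 : ∀ {w n} → ¬ n ≡ 2 → ¬ n ≡ 3 → ¬ EndOrInner w n
      not-2-or-3 n≢2 _ (inj₁ (_ , n≡2)) = n≢2 n≡2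
      not-2-or-3 _ n≢3 (inj₂ (_ , n≡3)) = n≢3 n≡3

      end-plane : ∀ w → w ≡ s ⊎ w ≡ t → Nonzero (chordPlane w) × PlaneThroughLine (P s) (P t) (chordPlane w) × ℋ (suc zero) (chordPlane w)
      end-plane w w∈st = chordPlane-nonzero w , (chordPlane-∋s w , chordPlane-∋t w) ,
                         not-osculating _ (chordPlane-∋s w) (chordPlane-∋t w) , meetCount-end w w∈st

      end-cover : ∀ {π} w → π ~ chordPlane w → EndOrInner w 2 → π ~ chordPlane s ⊎ π ~ chordPlane t
      end-cover w π~pw (inj₁ (inj₁ refl , _)) = inj₁ π~pw
      end-cover w π~pw (inj₁ (inj₂ refl , _)) = inj₂ π~pw
      end-cover w π~pw (inj₂ (_ , ()))

      inner-cover : ∀ {π} w → π ~ chordPlane w → EndOrInner w 3 → Σ Param λ w → (¬ w ≡ s × ¬ w ≡ t) × π ~ chordPlane w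
      inner-cover w π~pw (inj₁ (_ , ()))
      inner-cover w π~pw (inj₂ (w∉st , _)) = w , w∉st , π~pw

    chord-OD₂ : OD₂ (P s) (P t) (0 ∷ 2 ∷ card ℕ.∸ 1 ∷ 0 ∷ 0 ∷ [])
    chord-OD₂ zero = countMod-none λ π (_ , (π∋s , π∋t) , osc) → not-osculating π π∋s π∋t osc
    chord-OD₂ (suc zero) =
        (chordPlane s ∷ chordPlane t ∷ []) , refl , (end-plane s (inj₁ refl) ∷ end-plane t (inj₂ refl) ∷ []) , ((ends≁ ∷ []) ∷ [] ∷ []) ,
        λ π (π≢0 , π∋st , _ , count) → cover (let (w , π~pw , end) = classify (π≢0 , π∋st) count in end-cover w π~pw end)
      where
        cover : ∀ {π} → π ~ chordPlane s ⊎ π ~ chordPlane t → Any (π ~_) (chordPlane s ∷ chordPlane t ∷ [])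
        cover (inj₁ π~ps) = here π~ps
        cover (inj₂ π~pt) = there (here π~pt)
    chord-OD₂ (suc (suc zero)) =
      countMod-image {Q = λ π → Nonzero π × PlaneThroughLine (P s) (P t) π × MeetCount π 3} chordPlane inner-params-count
        (λ {w} (w≢s , w≢t) → chordPlane-nonzero w , (chordPlane-∋s w , chordPlane-∋t w) , meetCount-inner w w≢s w≢t)
        (λ (w≢s , w≢t) _ → chordPlane-injective w≢s w≢t)
        (λ π (π≢0 , π∋st , count) → let (w , π~pw , inner) = classify (π≢0 , π∋st) count in inner-cover w π~pw inner)
    chord-OD₂ (suc (suc (suc zero))) =
      countMod-none λ π (π≢0 , π∋st , _ , count) → let (_ , _ , e) = classify (π≢0 , π∋st) count in not-2-or-3 (λ ()) (λ ()) e
    chord-OD₂ (suc (suc (suc (suc zero)))) =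
      countMod-none λ π (π≢0 , π∋st , count) → let (_ , _ , e) = classify (π≢0 , π∋st) count in not-2-or-3 (λ ()) (λ ()) e

module PointsOnChord (𝔽 : FiniteField) (s t : Geometry.Param 𝔽) (s≢t : ¬ s ≡ t) where

  open BinaryForms 𝔽
  open PlanesThroughChord 𝔽 s t s≢t using (σ; τ; D; D≢0)

  chordPoint : Carrier → V
  chordPoint l = (1# · P s) ⊕ ((- l) · P t)

  chordPoint-on-chord : ∀ l → OnLine (P s) (P t) (chordPoint l)
  chordPoint-on-chord l = 1# , - l , refl

  dot-chordPoint : ∀ π l → dot π (chordPoint l) ≡ dot π (P s) - l * dot π (P t)
  dot-chordPoint π l = trans (dot-linear π 1# (- l) (P s) (P t))
    (solve 3 (λ a b l → c1 :* a :+ (:- l) :* b := a :- l :* b) refl (dot π (P s)) (dot π (P t)) l)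

  Πt·Ps≢0 : ¬ dot (Π t) (P s) ≡ 0#
  Πt·Ps≢0 e = s≢t (sym (Π-P≡0⇒≡ t s e))

  Πs·Pt≢0 : ¬ dot (Π s) (P t) ≡ 0#
  Πs·Pt≢0 e = s≢t (Π-P≡0⇒≡ s t e)

  Πt·chordPoint : ∀ l → dot (Π t) (chordPoint l) ≡ dot (Π t) (P s)
  Πt·chordPoint l = trans (dot-chordPoint (Π t) l) (trans (cong (λ z → dot (Π t) (P s) - l * z) (Π-P-self t))
    (solve 2 (λ a l → a :- l :* c0 := a) refl (dot (Π t) (P s)) l))

  Πs·chordPoint : ∀ l → dot (Π s) (chordPoint l) ≡ - (l * dot (Π s) (P t))
  Πs·chordPoint l = trans (dot-chordPoint (Π s) l) (trans (cong (_- l * dot (Π s) (P t)) (Π-P-self s)) (+-identityˡ _))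

  chordPoint-nonzero : ∀ l → Nonzero (chordPoint l)
  chordPoint-nonzero l x≡0 = Πt·Ps≢0 (trans (sym (Πt·chordPoint l)) (trans (cong (dot (Π t)) x≡0) (dot-zeroʳ (Π t))))

  -- Π t fixes the scalar to 1, then Π s reads off l.
  chordPoint-injective : ∀ {l l'} → chordPoint l ~ chordPoint l' → l ≡ l'
  chordPoint-injective {l} {l'} (k , k≢0 , x≡kx') = -‿injective (*-cancelˡ Πs·Pt≢0 (begin
      Y * - l             ≡⟨ sym (-‿distribʳ-* Y l) ⟩
      - (Y * l)           ≡⟨ cong -_ (*-comm Y l) ⟩
      - (l * Y)           ≡⟨ sym (Πs·chordPoint l) ⟩
      dot (Π s) (chordPoint l)              ≡⟨ cong (dot (Π s)) x≡kx' ⟩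
      dot (Π s) (k · chordPoint l')         ≡⟨ dot-scaleʳ (Π s) k (chordPoint l') ⟩
      k * dot (Π s) (chordPoint l')         ≡⟨ cong₂ _*_ k≡1 (Πs·chordPoint l') ⟩
      1# * - (l' * Y)     ≡⟨ *-identityˡ _ ⟩
      - (l' * Y)          ≡⟨ cong -_ (*-comm l' Y) ⟩
      - (Y * l')          ≡⟨ -‿distribʳ-* Y l' ⟩
      Y * - l'            ∎))
    where
      open ≡-Reasoning
      X = dot (Π t) (P s)
      Y = dot (Π s) (P t)
      k≡1 : k ≡ 1#
      k≡1 = *-cancelˡ Πt·Ps≢0 (begin
        X * k                                ≡⟨ *-comm X k ⟩
        k * X                                ≡⟨ cong (k *_) (sym (Πt·chordPoint l')) ⟩
        k * dot (Π t) (chordPoint l')         ≡⟨ sym (dot-scaleʳ (Π t) k (chordPoint l')) ⟩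
        dot (Π t) (k · chordPoint l')         ≡⟨ cong (dot (Π t)) (sym x≡kx') ⟩
        dot (Π t) (chordPoint l)              ≡⟨ Πt·chordPoint l ⟩
        X                                    ≡⟨ sym (*-identityʳ X) ⟩
        X * 1#                               ∎)

  P-nonzero : ∀ u → Nonzero (P u)
  P-nonzero (just _) P≡0 = 1≢0 (cong head P≡0)
  P-nonzero nothing P≡0 = 1≢0 (cong last P≡0)

  Ps≁Pt : ¬ P s ~ P t
  Ps≁Pt (k , _ , Ps≡kPt) = Πt·Ps≢0 (trans (cong (dot (Π t)) Ps≡kPt) (trans (dot-scaleʳ (Π t) k (P t)) (trans (cong (k *_) (Π-P-self t)) (zeroʳ k))))

  Ps-on-chord : OnLine (P s) (P t) (P s)
  Ps-on-chord = 1# , 0# , sym (trans (cong ((1# · P s) ⊕_) (·-zeroˡ (P t))) (trans (⊕-identityʳ _) (·-identityˡ (P s))))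

  Pt-on-chord : OnLine (P s) (P t) (P t)
  Pt-on-chord = 0# , 1# , sym (trans (cong (_⊕ (1# · P t)) (·-zeroˡ (P s))) (trans (⊕-identityˡ _) (·-identityˡ (P t))))

  ChordPointClass : V → Set
  ChordPointClass y = y ~ P s ⊎ y ~ P t ⊎ Σ Carrier λ l → ¬ l ≡ 0# × y ~ chordPoint l

  classify : ∀ y → Nonzero y → OnLine (P s) (P t) y → ChordPointClass y
  classify y y≢0 (α , β , y≡αPs+βPt) = cases (α ≟ 0#) (β ≟ 0#)
    where
      cases : Dec (α ≡ 0#) → Dec (β ≡ 0#) → ChordPointClass y
      cases (yes refl) (yes refl) = ⊥-elim (y≢0 (trans y≡αPs+βPt (trans (cong₂ _⊕_ (·-zeroˡ (P s)) (·-zeroˡ (P t))) (⊕-identityˡ 0v))))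
      cases (no α≢0) (yes refl) = inj₁ (α , α≢0 , trans y≡αPs+βPt (trans (cong ((α · P s) ⊕_) (·-zeroˡ (P t))) (⊕-identityʳ _)))
      cases (yes refl) (no β≢0) = inj₂ (inj₁ (β , β≢0 , trans y≡αPs+βPt (trans (cong (_⊕ (β · P t)) (·-zeroˡ (P s))) (⊕-identityˡ _))))
      cases (no α≢0) (no β≢0) = inj₂ (inj₂ (l , -‿≢0 (*-≢0 β≢0 (⁻¹-≢0 α≢0)) , α , α≢0 , trans y≡αPs+βPt (sym α·chordPoint)))
        where
          l = - (β * α ⁻¹)
          α·chordPoint : α · chordPoint l ≡ (α · P s) ⊕ (β · P t)
          α·chordPoint = begin
            α · ((1# · P s) ⊕ ((- l) · P t))           ≡⟨ ·-distrib-⊕ α (1# · P s) ((- l) · P t) ⟩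
            (α · (1# · P s)) ⊕ (α · ((- l) · P t))     ≡⟨ cong₂ _⊕_ (trans (·-assoc α 1# (P s)) (cong (_· P s) (*-identityʳ α)))
                                                                      (trans (·-assoc α (- l) (P t)) (cong (_· P t) α*[-l]≡β)) ⟩
            (α · P s) ⊕ (β · P t)                      ∎
            where
              open ≡-Reasoning
              α*[-l]≡β : α * - l ≡ β
              α*[-l]≡β = trans (cong (α *_) (-‿involutive _))
                (trans (*-comm α _) (trans (*-assoc β _ α) (trans (cong (β *_) (⁻¹-inverseˡ α≢0)) (*-identityʳ β))))

  -- A plane through the tangent line at P u: its cubic form has a double root at u.
  tangentPlane : Param → F² → V
  tangentPlane u b = planeThrough (homog u) b (homog u)

  P-on-tangentPlane : ∀ u b → OnPlane (tangentPlane u b) (P u)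
  P-on-tangentPlane u b = trans (dot-planeThrough-P μ b μ u) (trans (cong (λ z → z * det₂ μ b * z) (det₂-self μ)) (zeroʳ _))
    where μ = homog u

  tangentLine-on-tangentPlane : ∀ u b {y} → OnLine (P u) (T u) y → OnPlane (tangentPlane u b) y
  tangentLine-on-tangentPlane u b (α , β , y≡) = trans (cong (dot (tangentPlane u b)) y≡)
    (trans (dot-linear (tangentPlane u b) α β (P u) (T u))
      (trans (cong₂ (λ p q → α * p + β * q) (P-on-tangentPlane u b) (T-on-planeThrough u (homog u) b (homog u) (det₂-self (homog u)) (det₂-self (homog u))))
        (solve 2 (λ α β → α :* c0 :+ β :* c0 := c0) refl α β)))

  x*y*x≡0⇒x≡0 : ∀ {x y} → ¬ y ≡ 0# → x * y * x ≡ 0# → x ≡ 0#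
  x*y*x≡0⇒x≡0 {x} y≢0 xyx≡0 with x ≟ 0#
  ... | yes x≡0 = x≡0
  ... | no x≢0 = ⊥-elim (*-≢0 (*-≢0 x≢0 y≢0) x≢0 xyx≡0)

  -- Through σ the cubic form forces u = s, through τ it forces u = t.
  chordPoint-off-tangentPlanes : ∀ {l} → ¬ l ≡ 0# → ∀ u → ¬ (∀ b → OnPlane (tangentPlane u b) (chordPoint l))
  chordPoint-off-tangentPlanes {l} l≢0 u on-all = s≢t (trans (sym (det₂-homog≡0⇒≡ u s (det₂≡0-sym σμ≡0))) (det₂-homog≡0⇒≡ u t (det₂≡0-sym τμ≡0)))
    where
      μ = homog u
      form : ∀ b → dot (tangentPlane u b) (chordPoint l) ≡ det₂ σ μ * det₂ σ b * det₂ σ μ - l * (det₂ τ μ * det₂ τ b * det₂ τ μ)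
      form b = trans (dot-chordPoint (tangentPlane u b) l) (cong₂ (λ p q → p - l * q) (dot-planeThrough-P μ b μ s) (dot-planeThrough-P μ b μ t))
      σμ≡0 : det₂ σ μ ≡ 0#
      σμ≡0 = x*y*x≡0⇒x≡0 D≢0 (begin
        det₂ σ μ * D * det₂ σ μ
          ≡⟨ solve 4 (λ a d l c → a :* d :* a := a :* d :* a :- l :* (c :* c0 :* c)) refl (det₂ σ μ) D l (det₂ τ μ) ⟩
        det₂ σ μ * D * det₂ σ μ - l * (det₂ τ μ * 0# * det₂ τ μ)
          ≡⟨ cong (λ z → det₂ σ μ * D * det₂ σ μ - l * (det₂ τ μ * z * det₂ τ μ)) (sym (det₂-self τ)) ⟩
        det₂ σ μ * D * det₂ σ μ - l * (det₂ τ μ * det₂ τ τ * det₂ τ μ)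
          ≡⟨ sym (form τ) ⟩
        dot (tangentPlane u τ) (chordPoint l)
          ≡⟨ on-all τ ⟩
        0# ∎)
        where open ≡-Reasoning
      τμ≡0 : det₂ τ μ ≡ 0#
      τμ≡0 = x*y*x≡0⇒x≡0 (λ τσ≡0 → D≢0 (det₂≡0-sym τσ≡0)) (x*y≡0∧x≢0⇒y≡0 (-‿injective (trans (begin
        - (l * X)
          ≡⟨ solve 3 (λ a l x → :- (l :* x) := a :* c0 :* a :- l :* x) refl (det₂ σ μ) l X ⟩
        det₂ σ μ * 0# * det₂ σ μ - l * X
          ≡⟨ cong (λ z → det₂ σ μ * z * det₂ σ μ - l * X) (sym (det₂-self σ)) ⟩
        det₂ σ μ * det₂ σ σ * det₂ σ μ - l * X
          ≡⟨ sym (form σ) ⟩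
        dot (tangentPlane u σ) (chordPoint l)
          ≡⟨ on-all σ ⟩
        0# ∎) (sym -0#≈0#))) l≢0)
        where
          open ≡-Reasoning
          X = det₂ τ μ * det₂ τ σ * det₂ τ μ

  chordPoint-not-on-curve : ∀ {l y} → ¬ l ≡ 0# → y ~ chordPoint l → ¬ OnC y
  chordPoint-not-on-curve l≢0 y~x (u , y~Pu) = chordPoint-off-tangentPlanes l≢0 u
    (λ b → OnPlane-respʳ-~ (tangentPlane u b) (~-sym (~-trans (~-sym y~x) y~Pu)) (P-on-tangentPlane u b))

  chordPoint-not-on-tangent : ∀ {l y} → ¬ l ≡ 0# → y ~ chordPoint l → ¬ OnTangent y
  chordPoint-not-on-tangent l≢0 y~x (u , y-on-tangent) = chordPoint-off-tangentPlanes l≢0 u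
    (λ b → OnPlane-respʳ-~ (tangentPlane u b) y~x (tangentLine-on-tangentPlane u b y-on-tangent))

  bσ bτ : Param → Carrier
  bσ u = det₂ (homog u) σ
  bτ u = det₂ (homog u) τ

  Π·chordPoint : ∀ u l → dot (Π u) (chordPoint l) ≡ Π-sign u * (cube (bσ u) - l * cube (bτ u))
  Π·chordPoint u l = trans (dot-chordPoint (Π u) l) (trans (cong₂ (λ p q → p - l * q) (dot-Π-P u s) (dot-Π-P u t))
    (solve 4 (λ g a b l → g :* a :- l :* (g :* b) := g :* (a :- l :* b)) refl (Π-sign u) (cube (bσ u)) (cube (bτ u)) l))

  osculating⇒ : ∀ l u → OnPlane (Π u) (chordPoint l) → cube (bσ u) - l * cube (bτ u) ≡ 0#
  osculating⇒ l u on = x*y≡0∧x≢0⇒y≡0 (trans (sym (Π·chordPoint u l)) on) (Π-sign-≢0 u)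

  osculating⇐ : ∀ l u → cube (bσ u) - l * cube (bτ u) ≡ 0# → OnPlane (Π u) (chordPoint l)
  osculating⇐ l u e = trans (Π·chordPoint u l) (trans (cong (Π-sign u *_) e) (zeroʳ _))

  osculating⇒bτ≢0 : ∀ l u → OnPlane (Π u) (chordPoint l) → ¬ bτ u ≡ 0#
  osculating⇒bτ≢0 l u on bτ≡0 = det₂≡0∧det₂≡0⇒zero (homog u) σ τ D≢0 bσ≡0 bτ≡0 (homog-nonzero u)
    where
      bσ≡0 : bσ u ≡ 0#
      bσ≡0 = cube≡0⇒x≡0 (begin
        cube (bσ u)                             ≡⟨ solve 2 (λ a l → a :* a :* a := a :* a :* a :- l :* (c0 :* c0 :* c0)) refl (bσ u) l ⟩
        cube (bσ u) - l * cube 0#               ≡⟨ cong (λ z → cube (bσ u) - l * cube z) (sym bτ≡0) ⟩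
        cube (bσ u) - l * cube (bτ u)           ≡⟨ osculating⇒ l u on ⟩
        0#                                      ∎)
        where open ≡-Reasoning

  φ : Param → Carrier
  φ u = bσ u * bτ u ⁻¹

  ψ : Carrier → Param
  ψ w = toParam (σ -₂ (w ·₂ τ))

  cube-φ : ∀ l u → OnPlane (Π u) (chordPoint l) → cube (φ u) ≡ l
  cube-φ l u on = begin
      cube (bσ u * i)                                          ≡⟨ solve 4 (λ a b i l → (a :* i) :* (a :* i) :* (a :* i) := (a :* a :* a :- l :* (b :* b :* b)) :* (i :* i :* i) :+ l :* ((b :* i) :* (b :* i) :* (b :* i))) refl (bσ u) (bτ u) i l ⟩
      (cube (bσ u) - l * cube (bτ u)) * cube i + l * cube (bτ u * i)  ≡⟨ cong₂ (λ p q → p * cube i + l * cube q) (osculating⇒ l u on) (⁻¹-inverse _ (osculating⇒bτ≢0 l u on)) ⟩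
      0# * cube i + l * cube 1#                                ≡⟨ solve 2 (λ i l → c0 :* (i :* i :* i) :+ l :* (c1 :* c1 :* c1) := l) refl i l ⟩
      l                                                        ∎
    where
      open ≡-Reasoning
      i = bτ u ⁻¹

  module _ (w : Carrier) where

    private
      σ-wτ≢0 : NonzeroPair (σ -₂ (w ·₂ τ))
      σ-wτ≢0 zero-pair = D≢0 (trans (sym det-σ-wτ-τ) (det₂-zero-pair _ τ (cong₂ _,_ (proj₁ zero-pair) (proj₂ zero-pair))))
        where
          det-σ-wτ-τ : det₂ (σ -₂ (w ·₂ τ)) τ ≡ D
          det-σ-wτ-τ = trans (det₂-subˡ σ (w ·₂ τ) τ) (trans (cong (λ z → D - z) (trans (det₂-scaleˡ w τ τ) (trans (cong (w *_) (det₂-self τ)) (zeroʳ w))))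
                         (solve 1 (λ d → d :- c0 := d) refl D))

      spec = toParam-spec (σ -₂ (w ·₂ τ)) σ-wτ≢0
      k = proj₁ spec

      k≢0 : ¬ k ≡ 0#
      k≢0 = proj₁ (proj₂ spec)

      k*bσ : k * bσ (ψ w) ≡ w * D
      k*bσ = begin
        k * bσ (ψ w)                       ≡⟨ sym (det₂-scaleˡ k (homog (ψ w)) σ) ⟩
        det₂ (k ·₂ homog (ψ w)) σ          ≡⟨ cong (λ z → det₂ z σ) (sym (proj₂ (proj₂ spec))) ⟩
        det₂ (σ -₂ (w ·₂ τ)) σ             ≡⟨ trans (det₂-subˡ σ (w ·₂ τ) σ) (cong₂ (λ p q → p - q) (det₂-self σ) (det₂-scaleˡ w τ σ)) ⟩
        0# - w * det₂ τ σ                  ≡⟨ cong (λ z → 0# - w * z) (det₂-antisym τ σ) ⟩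
        0# - w * - D                       ≡⟨ solve 2 (λ w d → c0 :- w :* (:- d) := w :* d) refl w D ⟩
        w * D                              ∎
        where open ≡-Reasoning

      k*bτ : k * bτ (ψ w) ≡ D
      k*bτ = begin
        k * bτ (ψ w)                       ≡⟨ sym (det₂-scaleˡ k (homog (ψ w)) τ) ⟩
        det₂ (k ·₂ homog (ψ w)) τ          ≡⟨ cong (λ z → det₂ z τ) (sym (proj₂ (proj₂ spec))) ⟩
        det₂ (σ -₂ (w ·₂ τ)) τ             ≡⟨ trans (det₂-subˡ σ (w ·₂ τ) τ) (cong₂ (λ p q → p - q) refl (det₂-scaleˡ w τ τ)) ⟩
        D - w * det₂ τ τ                   ≡⟨ cong (λ z → D - w * z) (det₂-self τ) ⟩
        D - w * 0#                         ≡⟨ solve 2 (λ w d → d :- w :* c0 := d) refl w D ⟩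
        D                                  ∎
        where open ≡-Reasoning

    osculating-ψ : ∀ {l} → cube w ≡ l → OnPlane (Π (ψ w)) (chordPoint l)
    osculating-ψ {l} w³≡l = osculating⇐ l (ψ w) (x*y≡0∧x≢0⇒y≡0 (begin
        cube k * (cube (bσ (ψ w)) - l * cube (bτ (ψ w)))
          ≡⟨ solve 4 (λ k a b l → (k :* k :* k) :* (a :* a :* a :- l :* (b :* b :* b)) := (k :* a) :* (k :* a) :* (k :* a) :- l :* ((k :* b) :* (k :* b) :* (k :* b))) refl k (bσ (ψ w)) (bτ (ψ w)) l ⟩
        cube (k * bσ (ψ w)) - l * cube (k * bτ (ψ w))
          ≡⟨ cong₂ (λ p q → cube p - l * cube q) k*bσ k*bτ ⟩
        cube (w * D) - l * cube D
          ≡⟨ solve 3 (λ w d l → (w :* d) :* (w :* d) :* (w :* d) :- l :* (d :* d :* d) := (d :* d :* d) :* (w :* w :* w :- l)) refl w D l ⟩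
        cube D * (cube w - l)
          ≡⟨ cong (λ z → cube D * z) (x≡y⇒x-y≡0 w³≡l) ⟩
        cube D * 0#
          ≡⟨ zeroʳ _ ⟩
        0# ∎) (cube-≢0 k≢0))
      where open ≡-Reasoning

    φ∘ψ : φ (ψ w) ≡ w
    φ∘ψ = begin
        bσ (ψ w) * bτ (ψ w) ⁻¹               ≡⟨ cong (_* bτ (ψ w) ⁻¹) bσ≡w*bτ ⟩
        w * bτ (ψ w) * bτ (ψ w) ⁻¹           ≡⟨ *-assoc w _ _ ⟩
        w * (bτ (ψ w) * bτ (ψ w) ⁻¹)         ≡⟨ cong (w *_) (⁻¹-inverse _ bτ≢0) ⟩
        w * 1#                               ≡⟨ *-identityʳ w ⟩
        w                                    ∎
      where
        open ≡-Reasoning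
        bτ≢0 : ¬ bτ (ψ w) ≡ 0#
        bτ≢0 bτ≡0 = D≢0 (trans (sym k*bτ) (trans (cong (k *_) bτ≡0) (zeroʳ k)))
        bσ≡w*bτ : bσ (ψ w) ≡ w * bτ (ψ w)
        bσ≡w*bτ = *-cancelˡ k≢0 (trans k*bσ (trans (cong (w *_) (sym k*bτ))
                    (trans (sym (*-assoc w k _)) (trans (cong (_* bτ (ψ w)) (*-comm w k)) (*-assoc k w _)))))

  -- By Cramer, D · homog u = bτ u · σ - bσ u · τ, a multiple of σ - φ u · τ.
  ψ∘φ : ∀ l u → OnPlane (Π u) (chordPoint l) → ψ (φ u) ≡ u
  ψ∘φ l u on = trans (cong toParam σ-φτ≡) (toParam-scale (i * D) u (*-≢0 (⁻¹-≢0 bτ≢0) D≢0))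
    where
      bτ≢0 = osculating⇒bτ≢0 l u on
      i = bτ u ⁻¹
      μ = homog u
      component : ∀ m σc τc → D * m ≡ bτ u * σc - bσ u * τc → σc - (bσ u * i) * τc ≡ (i * D) * m
      component m σc τc Dm≡ = begin
        σc - (bσ u * i) * τc                          ≡⟨ solve 6 (λ sc tc bs bt i m → sc :- (bs :* i) :* tc := i :* (bt :* sc :- bs :* tc) :+ (c1 :- bt :* i) :* sc) refl σc τc (bσ u) (bτ u) i m ⟩
        i * (bτ u * σc - bσ u * τc) + (1# - bτ u * i) * σc  ≡⟨ cong₂ (λ p q → i * p + (1# - q) * σc) (sym Dm≡) (⁻¹-inverse _ bτ≢0) ⟩
        i * (D * m) + (1# - 1#) * σc                  ≡⟨ solve 4 (λ i d m sc → i :* (d :* m) :+ (c1 :- c1) :* sc := (i :* d) :* m) refl i D m σc ⟩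
        (i * D) * m                                   ∎
        where open ≡-Reasoning
      σ-φτ≡ : σ -₂ (φ u ·₂ τ) ≡ (i * D) ·₂ μ
      σ-φτ≡ = cong₂ _,_ (component (proj₁ μ) (proj₁ σ) (proj₁ τ) (cong proj₁ (cramer μ σ τ)))
                        (component (proj₂ μ) (proj₂ σ) (proj₂ τ) (cong proj₂ (cramer μ σ τ)))

  osculating-count : ∀ {l n} → CountMod _≡_ (λ w → cube w ≡ l) n → OscCount (chordPoint l) n
  osculating-count {l} count = countMod-image ψ count (λ {w} → osculating-ψ w)
    (λ {w} {w'} _ _ ψw≡ψw' → trans (sym (φ∘ψ w)) (trans (cong φ ψw≡ψw') (φ∘ψ w')))
    (λ u on → φ u , cube-φ l u on , sym (ψ∘φ l u on))

  P-osculating-count : ∀ v → OscCount (P v) 1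
  P-osculating-count v = (v ∷ []) , refl , (Π-P-self v ∷ []) , ([] ∷ []) , λ u on → here (Π-P≡0⇒≡ u v on)

  OnChordIn : Fin 5 → V → Set
  OnChordIn i y = Nonzero y × OnLine (P s) (P t) y × 𝒫 i y

  osculating-count-at-end : ∀ {y n} v → y ~ P v → OscCount y n → n ≡ 1
  osculating-count-at-end v y~Pv count = Params.countMod≡-unique (OscCount-resp-~ y~Pv count) (P-osculating-count v) (λ x → x) (λ x → x)

  osculating-count-inner : ∀ {y l m n} → y ~ chordPoint l → OscCount y n → CountMod _≡_ (λ w → cube w ≡ l) m → n ≡ m
  osculating-count-inner y~x count roots = Params.countMod≡-unique (OscCount-resp-~ y~x count) (osculating-count roots) (λ x → x) (λ x → x)

  curve-points-count : CountMod _~_ (OnChordIn zero) 2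
  curve-points-count = (P s ∷ P t ∷ []) , refl , (P-nonzero s , Ps-on-chord , s , ~-refl) ∷ (P-nonzero t , Pt-on-chord , t , ~-refl) ∷ [] ,
                       ((Ps≁Pt ∷ []) ∷ [] ∷ []) , λ y (y≢0 , y-on , on-curve) → cover on-curve (classify y y≢0 y-on)
    where
      cover : ∀ {y} → OnC y → ChordPointClass y → Any (y ~_) (P s ∷ P t ∷ [])
      cover _ (inj₁ y~Ps) = here y~Ps
      cover _ (inj₂ (inj₁ y~Pt)) = there (here y~Pt)
      cover on-curve (inj₂ (inj₂ (l , l≢0 , y~x))) = ⊥-elim (chordPoint-not-on-curve l≢0 y~x on-curve)

  tangent-points-none : ∀ y → ¬ OnChordIn (suc zero) y
  tangent-points-none y (y≢0 , y-on , ¬on-curve , on-tangent) = excluded (classify y y≢0 y-on)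
    where
      excluded : ¬ ChordPointClass y
      excluded (inj₁ y~Ps) = ¬on-curve (s , y~Ps)
      excluded (inj₂ (inj₁ y~Pt)) = ¬on-curve (t , y~Pt)
      excluded (inj₂ (inj₂ (l , l≢0 , y~x))) = chordPoint-not-on-tangent l≢0 y~x on-tangent

  off-curve⇒inner : ∀ {y} → ¬ OnC y → ChordPointClass y → Σ Carrier λ l → ¬ l ≡ 0# × y ~ chordPoint l
  off-curve⇒inner ¬on-curve (inj₁ y~Ps) = ⊥-elim (¬on-curve (s , y~Ps))
  off-curve⇒inner ¬on-curve (inj₂ (inj₁ y~Pt)) = ⊥-elim (¬on-curve (t , y~Pt))
  off-curve⇒inner _ (inj₂ (inj₂ inner)) = inner

  chordPoint-in-class : ∀ {l} i → 𝒫 i (chordPoint l) → OnChordIn i (chordPoint l)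
  chordPoint-in-class {l} _ in-i = chordPoint-nonzero l , chordPoint-on-chord l , in-i

  module _ (q%3≢0 : ¬ card ℕ.% 3 ≡ 0) (q%6≡5 : card ℕ.% 6 ≡ 5) where

    open Cubes.WhenQ≡5Mod6 𝔽 q%3≢0 q%6≡5

    osculating-count-1 : ∀ {y n} → Nonzero y → OnLine (P s) (P t) y → OscCount y n → n ≡ 1
    osculating-count-1 {y} {n} y≢0 y-on count = by-class (classify y y≢0 y-on)
      where
        by-class : ChordPointClass y → n ≡ 1
        by-class (inj₁ y~Ps) = osculating-count-at-end s y~Ps count
        by-class (inj₂ (inj₁ y~Pt)) = osculating-count-at-end t y~Pt count
        by-class (inj₂ (inj₂ (l , _ , y~x))) = osculating-count-inner y~x count (cube-root-count l)

    not-osculating-count : ∀ {n} → ¬ n ≡ 1 → ∀ y → ¬ (Nonzero y × OnLine (P s) (P t) y × OscCount y n)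
    not-osculating-count n≢1 y (y≢0 , y-on , count) = n≢1 (osculating-count-1 y≢0 y-on count)

    chord-OD₀-q≡5 : OD₀ (P s) (P t) (2 ∷ 0 ∷ 0 ∷ card ℕ.∸ 1 ∷ 0 ∷ [])
    chord-OD₀-q≡5 zero = curve-points-count
    chord-OD₀-q≡5 (suc zero) = countMod-none tangent-points-none
    chord-OD₀-q≡5 (suc (suc zero)) = countMod-none (not-osculating-count (λ ()))
    chord-OD₀-q≡5 (suc (suc (suc zero))) =
      countMod-image {Q = OnChordIn (suc (suc (suc zero)))} chordPoint (Cubes.nonzero-count 𝔽)
        (λ {l} l≢0 → chordPoint-in-class (suc (suc (suc zero))) (chordPoint-not-on-curve l≢0 ~-refl , osculating-count (cube-root-count l)))
        (λ _ _ → chordPoint-injective)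
        (λ y (y≢0 , y-on , ¬on-curve , _) → off-curve⇒inner ¬on-curve (classify y y≢0 y-on))
    chord-OD₀-q≡5 (suc (suc (suc (suc zero)))) = countMod-none (not-osculating-count (λ ()))

  module _ (q%3≢0 : ¬ card ℕ.% 3 ≡ 0) (ω : Carrier) (ω²+ω+1≡0 : ω * ω + ω + 1# ≡ 0#) where

    open Cubes 𝔽 using (IsCube; isCube?)
    open Cubes.CubeRootOfUnity 𝔽 (Cubes.3#≢0 𝔽 q%3≢0) ω ω²+ω+1≡0

    InnerWith : (Carrier → Set) → V → Set
    InnerWith Q y = Σ Carrier λ l → (¬ l ≡ 0# × Q l) × y ~ chordPoint l

    OsculatingCases : V → ℕ → Set
    OsculatingCases y n = InnerWith IsCube y × n ≡ 3 ⊎ InnerWith (λ l → ¬ IsCube l) y × n ≡ 0 ⊎ OnC y × n ≡ 1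

    osculating-cases : ∀ {y n} → Nonzero y → OnLine (P s) (P t) y → OscCount y n → OsculatingCases y n
    osculating-cases {y} {n} y≢0 y-on count = by-class (classify y y≢0 y-on)
      where
        inner : ∀ l → ¬ l ≡ 0# → y ~ chordPoint l → Dec (IsCube l) → OsculatingCases y n
        inner l l≢0 y~x (yes cube) = inj₁ ((l , (l≢0 , cube) , y~x) , osculating-count-inner y~x count (cube-root-count l≢0 cube))
        inner l l≢0 y~x (no ¬cube) = inj₂ (inj₁ ((l , (l≢0 , ¬cube) , y~x) ,
          osculating-count-inner y~x count (countMod-none {_~_ = _≡_} (λ w w³≡l → ¬cube (w , w³≡l)))))
        by-class : ChordPointClass y → OsculatingCases y n
        by-class (inj₁ y~Ps) = inj₂ (inj₂ ((s , y~Ps) , osculating-count-at-end s y~Ps count))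
        by-class (inj₂ (inj₁ y~Pt)) = inj₂ (inj₂ ((t , y~Pt) , osculating-count-at-end t y~Pt count))
        by-class (inj₂ (inj₂ (l , l≢0 , y~x))) = inner l l≢0 y~x (isCube? l)

    chord-OD₀-q≡1 : OD₀ (P s) (P t) (2 ∷ 0 ∷ (card ℕ.∸ 1) ℕ./ 3 ∷ 0 ∷ 2 ℕ.* ((card ℕ.∸ 1) ℕ./ 3) ∷ [])
    chord-OD₀-q≡1 zero = curve-points-count
    chord-OD₀-q≡1 (suc zero) = countMod-none tangent-points-none
    chord-OD₀-q≡1 (suc (suc zero)) =
      countMod-image {Q = OnChordIn (suc (suc zero))} chordPoint nonzero-cube-count
        (λ {l} (l≢0 , cube) → chordPoint-in-class (suc (suc zero)) (osculating-count (cube-root-count l≢0 cube)))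
        (λ _ _ → chordPoint-injective)
        (λ y (y≢0 , y-on , count) → cubes-only (osculating-cases y≢0 y-on count))
      where
        cubes-only : ∀ {y} → OsculatingCases y 3 → InnerWith IsCube y
        cubes-only (inj₁ (inner , _)) = inner
        cubes-only (inj₂ (inj₁ (_ , ())))
        cubes-only (inj₂ (inj₂ (_ , ())))
    chord-OD₀-q≡1 (suc (suc (suc zero))) =
      countMod-none λ y (y≢0 , y-on , ¬on-curve , count) → off-curve-not-1 ¬on-curve (osculating-cases y≢0 y-on count)
      where
        off-curve-not-1 : ∀ {y} → ¬ OnC y → ¬ OsculatingCases y 1
        off-curve-not-1 _ (inj₁ (_ , ()))
        off-curve-not-1 _ (inj₂ (inj₁ (_ , ())))
        off-curve-not-1 ¬on-curve (inj₂ (inj₂ (on-curve , _))) = ¬on-curve on-curve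
    chord-OD₀-q≡1 (suc (suc (suc (suc zero)))) =
      countMod-image {Q = OnChordIn (suc (suc (suc (suc zero))))} chordPoint nonzero-noncube-count
        (λ (_ , ¬cube) → chordPoint-in-class (suc (suc (suc (suc zero))))
                                 (osculating-count (countMod-none {_~_ = _≡_} (λ w w³≡l → ¬cube (w , w³≡l)))))
        (λ _ _ → chordPoint-injective)
        (λ y (y≢0 , y-on , count) → noncubes-only (osculating-cases y≢0 y-on count))
      where
        noncubes-only : ∀ {y} → OsculatingCases y 0 → InnerWith (λ l → ¬ IsCube l) y
        noncubes-only (inj₁ (_ , ()))
        noncubes-only (inj₂ (inj₁ (inner , _))) = inner
        noncubes-only (inj₂ (inj₂ (_ , ())))

-- The projectivity g a b c d is induced on 𝒞 by the substitution (v₀ , v₁) ↦ (v₀ a + v₁ c , v₀ b + v₁ d) of PG(1,q).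
module Projectivities (𝔽 : FiniteField) where

  open BinaryForms 𝔽

  module _ (a b c d : Carrier) where

    act : F² → F²
    act (v₀ , v₁) = v₀ * a + v₁ * c , v₀ * b + v₁ * d

    g∘ν : ∀ v → g a b c d (ν v) ≡ ν (act v)
    g∘ν (v₀ , v₁) = vec≡
      (solve 6 (λ a b c d v₀ v₁ →
          (v₀ :* v₀ :* v₀) :* (a :* a :* a) :+ (v₀ :* v₀ :* v₁) :* (c3 :* (a :* a :* c)) :+ (v₀ :* v₁ :* v₁) :* (c3 :* (a :* c :* c)) :+ (v₁ :* v₁ :* v₁) :* (c :* c :* c)
        := (v₀ :* a :+ v₁ :* c) :* (v₀ :* a :+ v₁ :* c) :* (v₀ :* a :+ v₁ :* c)) refl a b c d v₀ v₁)
      (solve 6 (λ a b c d v₀ v₁ →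
          (v₀ :* v₀ :* v₀) :* (a :* a :* b) :+ (v₀ :* v₀ :* v₁) :* (a :* a :* d :+ c2 :* (a :* b :* c))
          :+ (v₀ :* v₁ :* v₁) :* (b :* c :* c :+ c2 :* (a :* c :* d)) :+ (v₁ :* v₁ :* v₁) :* (c :* c :* d)
        := (v₀ :* a :+ v₁ :* c) :* (v₀ :* a :+ v₁ :* c) :* (v₀ :* b :+ v₁ :* d)) refl a b c d v₀ v₁)
      (solve 6 (λ a b c d v₀ v₁ →
          (v₀ :* v₀ :* v₀) :* (a :* b :* b) :+ (v₀ :* v₀ :* v₁) :* (b :* b :* c :+ c2 :* (a :* b :* d))
          :+ (v₀ :* v₁ :* v₁) :* (a :* d :* d :+ c2 :* (b :* c :* d)) :+ (v₁ :* v₁ :* v₁) :* (c :* d :* d)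
        := (v₀ :* a :+ v₁ :* c) :* (v₀ :* b :+ v₁ :* d) :* (v₀ :* b :+ v₁ :* d)) refl a b c d v₀ v₁)
      (solve 6 (λ a b c d v₀ v₁ →
          (v₀ :* v₀ :* v₀) :* (b :* b :* b) :+ (v₀ :* v₀ :* v₁) :* (c3 :* (b :* b :* d)) :+ (v₀ :* v₁ :* v₁) :* (c3 :* (b :* d :* d)) :+ (v₁ :* v₁ :* v₁) :* (d :* d :* d)
        := (v₀ :* b :+ v₁ :* d) :* (v₀ :* b :+ v₁ :* d) :* (v₀ :* b :+ v₁ :* d)) refl a b c d v₀ v₁)

    g-linear : ∀ α β u w → g a b c d ((α · u) ⊕ (β · w)) ≡ (α · g a b c d u) ⊕ (β · g a b c d w)
    g-linear α β (u₀ ∷ u₁ ∷ u₂ ∷ u₃ ∷ []) (w₀ ∷ w₁ ∷ w₂ ∷ w₃ ∷ []) =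
        vec≡ (column _ _ _ _) (column _ _ _ _) (column _ _ _ _) (column _ _ _ _)
      where
        column : ∀ e₀ e₁ e₂ e₃ →
          (α * u₀ + β * w₀) * e₀ + (α * u₁ + β * w₁) * e₁ + (α * u₂ + β * w₂) * e₂ + (α * u₃ + β * w₃) * e₃
          ≡ α * (u₀ * e₀ + u₁ * e₁ + u₂ * e₂ + u₃ * e₃) + β * (w₀ * e₀ + w₁ * e₁ + w₂ * e₂ + w₃ * e₃)
        column e₀ e₁ e₂ e₃ = solve 14 (λ α β u₀ u₁ u₂ u₃ w₀ w₁ w₂ w₃ e₀ e₁ e₂ e₃ →
          (α :* u₀ :+ β :* w₀) :* e₀ :+ (α :* u₁ :+ β :* w₁) :* e₁ :+ (α :* u₂ :+ β :* w₂) :* e₂ :+ (α :* u₃ :+ β :* w₃) :* e₃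
          := α :* (u₀ :* e₀ :+ u₁ :* e₁ :+ u₂ :* e₂ :+ u₃ :* e₃) :+ β :* (w₀ :* e₀ :+ w₁ :* e₁ :+ w₂ :* e₂ :+ w₃ :* e₃))
          refl α β u₀ u₁ u₂ u₃ w₀ w₁ w₂ w₃ e₀ e₁ e₂ e₃

    det₂-act : ∀ v w → det₂ (act v) (act w) ≡ det a b c d * det₂ v w
    det₂-act (v₀ , v₁) (w₀ , w₁) = solve 8 (λ a b c d v₀ v₁ w₀ w₁ →
       (v₀ :* a :+ v₁ :* c) :* (w₀ :* b :+ w₁ :* d) :- (v₀ :* b :+ v₁ :* d) :* (w₀ :* a :+ w₁ :* c)
       := (a :* d :+ :- (b :* c)) :* (v₀ :* w₁ :- v₁ :* w₀)) refl a b c d v₀ v₁ w₀ w₁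

  module _ (a b c d : Carrier) (det≢0 : ¬ det a b c d ≡ 0#) where

    act-nonzero : ∀ u → NonzeroPair (act a b c d (homog u))
    act-nonzero u (e₀ , e₁) = det₂-homog′-homog-≢0 u (det₂≡0-sym (x*y≡0∧x≢0⇒y≡0
      (trans (sym (det₂-act a b c d (homog u) (homog′ u))) (det₂-zero-pair _ _ (cong₂ _,_ e₀ e₁))) det≢0))

    image : Param → Param
    image u = toParam (act a b c d (homog u))

    private
      scale : ∀ u → Σ Carrier λ k → ¬ k ≡ 0# × act a b c d (homog u) ≡ k ·₂ homog (image u)
      scale u = toParam-spec (act a b c d (homog u)) (act-nonzero u)

    g-P : ∀ u → Σ Carrier λ K → ¬ K ≡ 0# × g a b c d (P u) ≡ K · P (image u)
    g-P u = cube k , cube-≢0 k≢0 , (begin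
        g a b c d (P u)                     ≡⟨ cong (g a b c d) (P≡ν∘homog u) ⟩
        g a b c d (ν (homog u))             ≡⟨ g∘ν a b c d (homog u) ⟩
        ν (act a b c d (homog u))           ≡⟨ cong ν act≡ ⟩
        ν (k ·₂ homog (image u))            ≡⟨ ν-scale k (homog (image u)) ⟩
        cube k · ν (homog (image u))        ≡⟨ cong (cube k ·_) (sym (P≡ν∘homog (image u))) ⟩
        cube k · P (image u)                ∎)
      where
        open ≡-Reasoning
        k = proj₁ (scale u)
        k≢0 = proj₁ (proj₂ (scale u))
        act≡ = proj₂ (proj₂ (scale u))

    image-injective : ∀ {u v} → image u ≡ image v → u ≡ v
    image-injective {u} {v} image-u≡image-v = det₂-homog≡0⇒≡ u v (x*y≡0∧x≢0⇒y≡0 (begin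
        det a b c d * det₂ (homog u) (homog v)                ≡⟨ sym (det₂-act a b c d (homog u) (homog v)) ⟩
        det₂ (act a b c d (homog u)) (act a b c d (homog v))   ≡⟨ cong₂ det₂ (proj₂ (proj₂ (scale u))) (proj₂ (proj₂ (scale v))) ⟩
        det₂ (k ·₂ homog (image u)) (l ·₂ homog (image v))     ≡⟨ det₂-scaleˡ k _ _ ⟩
        k * det₂ (homog (image u)) (l ·₂ homog (image v))      ≡⟨ cong (k *_) (det₂-scaleʳ l _ _) ⟩
        k * (l * det₂ (homog (image u)) (homog (image v)))      ≡⟨ cong (λ z → k * (l * det₂ (homog (image u)) (homog z))) (sym image-u≡image-v) ⟩
        k * (l * det₂ (homog (image u)) (homog (image u)))      ≡⟨ cong (λ z → k * (l * z)) (det₂-self _) ⟩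
        k * (l * 0#)                                            ≡⟨ trans (cong (k *_) (zeroʳ l)) (zeroʳ k) ⟩
        0#                                                      ∎) det≢0)
      where
        open ≡-Reasoning
        k = proj₁ (scale u)
        l = proj₁ (scale v)

    span-image : ∀ {u w u' w' K L} → ¬ K ≡ 0# → ¬ L ≡ 0# → g a b c d u ≡ K · u' → g a b c d w ≡ L · w' →
                 SameLine (Image a b c d (Span u w)) (Span u' w')
    span-image {u} {w} {u'} {w'} {K} {L} K≢0 L≢0 gu≡ gw≡ x = forward , backward
      where
        g-combination : ∀ α β → g a b c d ((α · u) ⊕ (β · w)) ≡ ((α * K) · u') ⊕ ((β * L) · w')
        g-combination α β = trans (g-linear a b c d α β u w)
          (cong₂ _⊕_ (trans (cong (α ·_) gu≡) (·-assoc α K u')) (trans (cong (β ·_) gw≡) (·-assoc β L w')))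
        cancel : ∀ z {k} → ¬ k ≡ 0# → z * k ⁻¹ * k ≡ z
        cancel z {k} k≢0 = trans (*-assoc z _ k) (trans (cong (z *_) (⁻¹-inverseˡ k≢0)) (*-identityʳ z))
        forward : Image a b c d (Span u w) x → Span u' w' x
        forward (y , (α , β , y≡) , x≡gy) = α * K , β * L , trans x≡gy (trans (cong (g a b c d) y≡) (g-combination α β))
        backward : Span u' w' x → Image a b c d (Span u w) x
        backward (α , β , x≡) = ((α * K ⁻¹) · u) ⊕ ((β * L ⁻¹) · w) , (α * K ⁻¹ , β * L ⁻¹ , refl) ,
          trans x≡ (sym (trans (g-combination (α * K ⁻¹) (β * L ⁻¹))
            (cong₂ (λ p q → (p · u') ⊕ (q · w')) (cancel α K≢0) (cancel β L≢0))))

    chord-image : ∀ s t → SameLine (Image a b c d (Chord s t)) (Chord (image s) (image t))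
    chord-image s t = span-image (proj₁ (proj₂ (g-P s))) (proj₁ (proj₂ (g-P t))) (proj₂ (proj₂ (g-P s))) (proj₂ (proj₂ (g-P t)))

    chord-to-chord : ∀ s t → ¬ s ≡ t → Σ Param λ s' → Σ Param λ t' → ¬ s' ≡ t' × SameLine (Image a b c d (Chord s t)) (Chord s' t')
    chord-to-chord s t s≢t = image s , image t , (λ image-s≡image-t → s≢t (image-injective image-s≡image-t)) , chord-image s t

  -- The substitution taking homog s, homog t to D · homog s', D · homog t', with D = det₂ (homog s) (homog t).
  chord-transitive : ∀ s t s' t' → ¬ s ≡ t → ¬ s' ≡ t' →
    Σ Carrier λ a → Σ Carrier λ b → Σ Carrier λ c → Σ Carrier λ d →
      ¬ det a b c d ≡ 0# × SameLine (Image a b c d (Chord s t)) (Chord s' t')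
  chord-transitive s t s' t' s≢t s'≢t' =
      a , b , c , d , det≢0 ,
      subst₂ (λ u v → SameLine (Image a b c d (Chord s t)) (Chord u v)) (image-of s act-s) (image-of t act-t) (chord-image a b c d det≢0 s t)
    where
      σ₀ = proj₁ (homog s)
      σ₁ = proj₂ (homog s)
      τ₀ = proj₁ (homog t)
      τ₁ = proj₂ (homog t)
      p₀ = proj₁ (homog s')
      p₁ = proj₂ (homog s')
      q₀ = proj₁ (homog t')
      q₁ = proj₂ (homog t')
      a = τ₁ * p₀ - σ₁ * q₀
      b = τ₁ * p₁ - σ₁ * q₁
      c = σ₀ * q₀ - τ₀ * p₀
      d = σ₀ * q₁ - τ₀ * p₁
      D = det₂ (homog s) (homog t)

      det≢0 : ¬ det a b c d ≡ 0#
      det≢0 det≡0 = *-≢0 (det₂-homog-≢0 s≢t) (det₂-homog-≢0 s'≢t') (trans (sym det≡D*D') det≡0)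
        where
          det≡D*D' : det a b c d ≡ D * det₂ (homog s') (homog t')
          det≡D*D' = solve 8 (λ σ₀ σ₁ τ₀ τ₁ p₀ p₁ q₀ q₁ →
            (τ₁ :* p₀ :- σ₁ :* q₀) :* (σ₀ :* q₁ :- τ₀ :* p₁) :+ :- ((τ₁ :* p₁ :- σ₁ :* q₁) :* (σ₀ :* q₀ :- τ₀ :* p₀))
            := (σ₀ :* τ₁ :- σ₁ :* τ₀) :* (p₀ :* q₁ :- p₁ :* q₀)) refl σ₀ σ₁ τ₀ τ₁ p₀ p₁ q₀ q₁

      act-s : act a b c d (homog s) ≡ D ·₂ homog s'
      act-s = cong₂ _,_
        (solve 8 (λ σ₀ σ₁ τ₀ τ₁ p₀ p₁ q₀ q₁ → σ₀ :* (τ₁ :* p₀ :- σ₁ :* q₀) :+ σ₁ :* (σ₀ :* q₀ :- τ₀ :* p₀) := (σ₀ :* τ₁ :- σ₁ :* τ₀) :* p₀) refl σ₀ σ₁ τ₀ τ₁ p₀ p₁ q₀ q₁)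
        (solve 8 (λ σ₀ σ₁ τ₀ τ₁ p₀ p₁ q₀ q₁ → σ₀ :* (τ₁ :* p₁ :- σ₁ :* q₁) :+ σ₁ :* (σ₀ :* q₁ :- τ₀ :* p₁) := (σ₀ :* τ₁ :- σ₁ :* τ₀) :* p₁) refl σ₀ σ₁ τ₀ τ₁ p₀ p₁ q₀ q₁)

      act-t : act a b c d (homog t) ≡ D ·₂ homog t'
      act-t = cong₂ _,_
        (solve 8 (λ σ₀ σ₁ τ₀ τ₁ p₀ p₁ q₀ q₁ → τ₀ :* (τ₁ :* p₀ :- σ₁ :* q₀) :+ τ₁ :* (σ₀ :* q₀ :- τ₀ :* p₀) := (σ₀ :* τ₁ :- σ₁ :* τ₀) :* q₀) refl σ₀ σ₁ τ₀ τ₁ p₀ p₁ q₀ q₁)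
        (solve 8 (λ σ₀ σ₁ τ₀ τ₁ p₀ p₁ q₀ q₁ → τ₀ :* (τ₁ :* p₁ :- σ₁ :* q₁) :+ τ₁ :* (σ₀ :* q₁ :- τ₀ :* p₁) := (σ₀ :* τ₁ :- σ₁ :* τ₀) :* q₁) refl σ₀ σ₁ τ₀ τ₁ p₀ p₁ q₀ q₁)

      image-of : ∀ u {u'} → act a b c d (homog u) ≡ D ·₂ homog u' → image a b c d det≢0 u ≡ u'
      image-of _ {u'} act-u≡ = trans (cong toParam act-u≡) (toParam-scale D u' (det₂-homog-≢0 s≢t))

open import Data.Nat using (_%_; _∸_; _/_; _*_)

mainTheorem10 :
  (𝔽 : FiniteField) →
  FiniteField.card 𝔽 % 2 ≡ 1 → ¬ FiniteField.card 𝔽 % 3 ≡ 0 →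
  -- 𝓛₆ is a single G-orbit: G maps real chords to real chords ...
  ((a b c d : FiniteField.Carrier 𝔽) → ¬ Geometry.det 𝔽 a b c d ≡ FiniteField.0# 𝔽 → (s t : Geometry.Param 𝔽) → ¬ s ≡ t →
     Σ (Geometry.Param 𝔽) λ s' → Σ (Geometry.Param 𝔽) λ t' → ¬ s' ≡ t' ×
       Geometry.SameLine 𝔽 (Geometry.Image 𝔽 a b c d (Geometry.Chord 𝔽 s t)) (Geometry.Chord 𝔽 s' t'))
  -- ... and acts transitively on them
  × ((s t s' t' : Geometry.Param 𝔽) → ¬ s ≡ t → ¬ s' ≡ t' →
     Σ (FiniteField.Carrier 𝔽) λ a → Σ (FiniteField.Carrier 𝔽) λ b → Σ (FiniteField.Carrier 𝔽) λ c → Σ (FiniteField.Carrier 𝔽) λ d →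
       ¬ Geometry.det 𝔽 a b c d ≡ FiniteField.0# 𝔽 × Geometry.SameLine 𝔽 (Geometry.Image 𝔽 a b c d (Geometry.Chord 𝔽 s t)) (Geometry.Chord 𝔽 s' t'))
  -- orbit distributions of a real chord
  × ((s t : Geometry.Param 𝔽) → ¬ s ≡ t →
       (FiniteField.card 𝔽 % 6 ≡ 5 →
          Geometry.OD₂ 𝔽 (Geometry.P 𝔽 s) (Geometry.P 𝔽 t) (0 ∷ 2 ∷ FiniteField.card 𝔽 ∸ 1 ∷ 0 ∷ 0 ∷ [])
        × Geometry.OD₀ 𝔽 (Geometry.P 𝔽 s) (Geometry.P 𝔽 t) (2 ∷ 0 ∷ 0 ∷ FiniteField.card 𝔽 ∸ 1 ∷ 0 ∷ []))
     × (FiniteField.card 𝔽 % 6 ≡ 1 →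
          Geometry.OD₂ 𝔽 (Geometry.P 𝔽 s) (Geometry.P 𝔽 t) (0 ∷ 2 ∷ FiniteField.card 𝔽 ∸ 1 ∷ 0 ∷ 0 ∷ [])
        × Geometry.OD₀ 𝔽 (Geometry.P 𝔽 s) (Geometry.P 𝔽 t) (2 ∷ 0 ∷ (FiniteField.card 𝔽 ∸ 1) / 3 ∷ 0 ∷ 2 * ((FiniteField.card 𝔽 ∸ 1) / 3) ∷ [])))
mainTheorem10 𝔽 q-odd q%3≢0 =
    chord-to-chord
  , chord-transitive
  , λ s t s≢t → (λ q%6≡5 → chord-OD₂ s t s≢t , PointsOnChord.chord-OD₀-q≡5 𝔽 s t s≢t q%3≢0 q%6≡5)
              , (λ q%6≡1 → let (ω , ω²+ω+1≡0) = Cubes.cubeRootOfUnity 𝔽 q%6≡1 in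
                           chord-OD₂ s t s≢t , PointsOnChord.chord-OD₀-q≡1 𝔽 s t s≢t q%3≢0 ω ω²+ω+1≡0)
  where
    open Projectivities 𝔽
    chord-OD₂ : ∀ s t → ¬ s ≡ t → Geometry.OD₂ 𝔽 (Geometry.P 𝔽 s) (Geometry.P 𝔽 t) (0 ∷ 2 ∷ FiniteField.card 𝔽 ∸ 1 ∷ 0 ∷ 0 ∷ [])
    chord-OD₂ s t s≢t = let (a , a≢0 , a≢1) = Cubes.element-≢0,1 𝔽 q-odd in PlanesThroughChord.chord-OD₂ 𝔽 s t s≢t a a≢0 a≢1
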